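{- For every integer $l\ge 1$, $\chi_{la}(\theta(4l^{[3l+2]}, (4l+1)^{[l]}))=3$, where $\theta(4l^{[3l+2]}, (4l+1)^{[l]})$ is the bridge graph consisting of $3l+2$ internally disjoint $(u,v)$-paths of length $4l$ and $l$ further internally disjoint $(u,v)$-paths of length $4l+1$.
   Context: For a connected graph $G=(V,E)$, a local antimagic labeling is a bijection $f:E\to\{1,\dots,|E|\}$ such that $f^+(x)\neq f^+(y)$ for adjacent vertices $x,y$, where $f^+(x)=\sum_{e\ni x} f(e)$. The number of distinct values of $f^+$ is $c(f)$, and $\chi_{la}(G)$ is the minimum of $c(f)$ over all local antimagic labelings of $G$. A bridge graph $\theta(a_1,\dots,a_s)$ consists of two vertices $u,v$ joined by $s$ internally disjoint $(u,v)$-paths of lengths $a_1,\dots,a_s$. The notation $a^{[n]}$ denotes $n$ entries equal to $a$. -}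

module Defs where

open import Data.Nat using (ℕ; zero; suc; _+_; _*_; _∸_; _≤_; _≟_)
open import Data.Fin using (Fin)
open import Data.Product using (_×_; _,_; proj₁; proj₂; Σ; ∃)
open import Data.List using (List; []; _∷_; _++_; length; lookup; map; upTo; replicate; deduplicate; allFin)
open import Data.Nat.ListAction using (sum)
open import Relation.Nullary using (¬_; yes; no)
open import Relation.Binary.PropositionalEquality using (_≡_; _≢_)
open import Function.Bundles using (_↔_; Inverse)

-- A finite (multi)graph: vertices 0 … nV-1, edges given as a list of endpoint pairs.
record Graph : Set where
  constructor graph
  field
    nV    : ℕ
    edges : List (ℕ × ℕ)

open Graph public

nE : Graph → ℕ
nE G = length (edges G)

edge : (G : Graph) → Fin (nE G) → ℕ × ℕ
edge G = lookup (edges G)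

-- An edge labeling by a bijection  E → {1,…,|E|}:  e ↦ 1 + σ(e) for a permutation σ of Fin |E|.
Labeling : Graph → Set
Labeling G = Fin (nE G) ↔ Fin (nE G)

label : (G : Graph) → Labeling G → Fin (nE G) → ℕ
label G σ e = suc (Data.Fin.toℕ (Inverse.to σ e))

incid : ℕ → ℕ × ℕ → ℕ → ℕ
incid x (a , b) w with x ≟ a | x ≟ b
... | yes _ | _     = w
... | no _  | yes _ = w
... | no _  | no _  = 0

fplus : (G : Graph) → Labeling G → ℕ → ℕ
fplus G σ x = sum (map (λ e → incid x (edge G e) (label G σ e)) (allFin (nE G)))

IsLocalAntimagic : (G : Graph) → Labeling G → Set
IsLocalAntimagic G σ =
  (e : Fin (nE G)) → fplus G σ (proj₁ (edge G e)) ≢ fplus G σ (proj₂ (edge G e))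

numColors : (G : Graph) → Labeling G → ℕ
numColors G σ = length (deduplicate _≟_ (map (fplus G σ) (upTo (nV G))))

ChiLaEq : Graph → ℕ → Set
ChiLaEq G k =
  (Σ (Labeling G) λ σ → IsLocalAntimagic G σ × numColors G σ ≡ k)
  × ((σ : Labeling G) → IsLocalAntimagic G σ → k ≤ numColors G σ)

-- Bridge graph θ(a₁,…,a_s): u = 0, v = 1, internal vertices numbered from 2 on.
-- chain n k : path n → n+1 → … → n+k → v
chain : ℕ → ℕ → List (ℕ × ℕ)
chain n zero    = (n , 1) ∷ []
chain n (suc k) = (n , suc n) ∷ chain (suc n) k

-- a (u,v)-path of length a whose internal vertices are n, …, n+a-2
pathEdges : ℕ → ℕ → List (ℕ × ℕ)
pathEdges n zero          = []
pathEdges n (suc zero)    = (0 , 1) ∷ []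
pathEdges n (suc (suc k)) = (0 , n) ∷ chain n k

thetaEdges : ℕ → List ℕ → List (ℕ × ℕ)
thetaEdges n []       = []
thetaEdges n (a ∷ as) = pathEdges n a ++ thetaEdges (n + (a ∸ 1)) as

theta : List ℕ → Graph
theta as = graph (2 + sum (map (_∸ 1) as)) (thetaEdges 2 as)

-- Upper bound: an explicit labelling. With s = 4l + 2 and M = 4ls + l + 1, the labels along every path are
-- interleaved arithmetic progressions of step s (one rising from a small label x, one falling to D₀ + x′ with
-- x + x′ = s), so consecutive labels sum alternately to M and M + s. Hence every internal vertex gets M or M + s and
-- neighbours on a path differ. The paths form series in which x and x′ run through complementary ranges, so that the
-- labels are exactly 1, …, |E| and u and v receive the same sum c > M + s: three values in total.
--
-- Lower bound: the vertex sums of a local antimagic labelling form a proper colouring. If only two values occurred,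
-- they would alternate along every (u,v)-path, so a path of even length 4l and one of odd length 4l + 1 would force
-- different values at v.

module Submission where

open import Defs
open import Data.Nat using (ℕ; zero; suc; _+_; _*_; _∸_; _≤_; _<_; z≤n; s≤s; s≤s⁻¹; pred; _≟_; _≤?_; _<?_)
open import Data.Nat.Properties
open import Data.Nat.DivMod using (_/_; _%_; m≡m%n+[m/n]*n; m%n<n)
open import Data.Nat.ListAction using (sum)
open import Data.Nat.ListAction.Properties using (sum-++)
open import Data.Nat.Tactic.RingSolver using (solve-∀)
open import Data.Fin using (Fin; toℕ; fromℕ<; cast; punchOut)
import Data.Fin as Fin
open import Data.Fin.Properties as Finₚ
  using (any?; pigeonhole; punchOut-injective; toℕ-fromℕ<; toℕ-injective; toℕ<n; cast-involutive)
open import Data.Product using (_×_; _,_; proj₁; proj₂; Σ; ∃; ∃₂)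
open import Data.Sum using (_⊎_; inj₁; inj₂)
open import Data.List using (List; []; _∷_; _++_; length; lookup; map; concatMap; tabulate; upTo; deduplicate; replicate)
open import Data.List.Properties using (map-tabulate; tabulate-cong; length-++; map-++; ++-assoc; ++-identityʳ)
open import Data.List.Membership.Propositional using (_∈_)
open import Data.List.Membership.Propositional.Properties
  using ( ∈-∃++; ∈-upTo⁺; ∈-upTo⁻; ∈-map⁺; ∈-map⁻; ∈-deduplicate⁺; ∈-deduplicate⁻; ∈-lookup; ∈-concat⁺′
        ; ∈-++⁺ˡ; ∈-++⁺ʳ)
open import Data.List.Relation.Unary.Any using (here; there; index)
open import Data.List.Relation.Unary.Any.Properties using (lookup-index)
open import Data.List.Relation.Unary.All using (All; []; _∷_)
import Data.List.Relation.Unary.All as All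
open import Data.List.Relation.Unary.All.Properties using (++⁺; ++⁻ˡ; ++⁻ʳ; concat⁺; map⁺)
open import Data.List.Relation.Unary.AllPairs using ([]; _∷_)
open import Data.List.Relation.Unary.Unique.Propositional using (Unique)
open import Data.List.Relation.Unary.Unique.DecPropositional.Properties using (deduplicate-!)
open import Data.Unit using (⊤; tt)
open import Data.Empty using (⊥-elim)
open import Relation.Nullary using (Dec; yes; no)
open import Relation.Binary.PropositionalEquality
  using (_≡_; _≢_; ≢-sym; refl; sym; trans; cong; cong₂; subst; subst₂; module ≡-Reasoning)
open import Function.Bundles using (_↔_; mk↔ₛ′)

Fin-injective⇒surjective : ∀ n (h : Fin n → Fin n) → (∀ {a b} → h a ≡ h b → a ≡ b) →
                           ∀ y → ∃ λ x → h x ≡ y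
Fin-injective⇒surjective zero    h inj ()
Fin-injective⇒surjective (suc n) h inj y with any? (λ x → h x Fin.≟ y)
... | yes found = found
... | no  ¬found = collision (pigeonhole (n<1+n n) h′)
  where
  missed : ∀ x → y ≢ h x
  missed x y≡hx = ¬found (x , sym y≡hx)
  -- Omitting y, h maps n+1 points into n, so two of them collide.
  h′ : Fin (suc n) → Fin n
  h′ x = punchOut (missed x)
  collision : (∃₂ λ i j → i Fin.< j × h′ i ≡ h′ j) → ∃ λ x → h x ≡ y
  collision (i , j , i<j , h′i≡h′j) = ⊥-elim (Finₚ.<⇒≢ i<j (inj (punchOut-injective (missed i) (missed j) h′i≡h′j)))

surjection⇒permutation : ∀ {n} (g : Fin n → Fin n) → (∀ y → ∃ λ x → g x ≡ y) → Fin n ↔ Fin n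
surjection⇒permutation {n} g surj = mk↔ₛ′ g section g∘section section∘g
  where
  section : Fin n → Fin n
  section y = proj₁ (surj y)
  g∘section : ∀ y → g (section y) ≡ y
  g∘section y = proj₂ (surj y)
  section-injective : ∀ {a b} → section a ≡ section b → a ≡ b
  section-injective {a} {b} e = trans (sym (g∘section a)) (trans (cong g e) (g∘section b))
  section∘g : ∀ x → section (g x) ≡ x
  section∘g x with Fin-injective⇒surjective n section section-injective x
  ... | y , refl = cong section (g∘section y)

Unique⊆⇒length≤ : ∀ {A : Set} (xs S : List A) → Unique xs → All (_∈ S) xs → length xs ≤ length S
Unique⊆⇒length≤ []       S _                _               = z≤n
Unique⊆⇒length≤ (x ∷ xs) S (x∉xs ∷ unique) (x∈S ∷ xs⊆S) with ∈-∃++ x∈S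
... | S₁ , S₂ , refl = ≤-trans (s≤s (Unique⊆⇒length≤ xs (S₁ ++ S₂) unique (shrink xs x∉xs xs⊆S)))
                               (≤-reflexive (sym (length-middle S₁)))
  where
  drop : ∀ {z} (T : List _) → z ∈ T ++ x ∷ S₂ → z ≢ x → z ∈ T ++ S₂
  drop []      (here z≡x) z≢x = ⊥-elim (z≢x z≡x)
  drop []      (there z∈) _   = z∈
  drop (t ∷ T) (here z≡t) _   = here z≡t
  drop (t ∷ T) (there z∈) z≢x = there (drop T z∈ z≢x)
  shrink : ∀ ys → All (x ≢_) ys → All (_∈ S₁ ++ x ∷ S₂) ys → All (_∈ S₁ ++ S₂) ys
  shrink []       _              _           = []
  shrink (y ∷ ys) (x≢y ∷ x≢ys) (y∈ ∷ ys∈) = drop S₁ y∈ (λ y≡x → x≢y (sym y≡x)) ∷ shrink ys x≢ys ys∈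
  length-middle : ∀ T → length (T ++ x ∷ S₂) ≡ suc (length (T ++ S₂))
  length-middle []      = refl
  length-middle (t ∷ T) = cong suc (length-middle T)

module _ (G : Graph) (σ : Labeling G) where

  private
    colours : List ℕ
    colours = deduplicate _≟_ (map (fplus G σ) (upTo (nV G)))

    colour∈ : ∀ {x} → x < nV G → fplus G σ x ∈ colours
    colour∈ x< = ∈-deduplicate⁺ _≟_ (∈-map⁺ (fplus G σ) (∈-upTo⁺ x<))

  three-colours⇒3≤numColors : ∀ a b c → a < nV G → b < nV G → c < nV G →
    fplus G σ a ≢ fplus G σ b → fplus G σ a ≢ fplus G σ c → fplus G σ b ≢ fplus G σ c →
    3 ≤ numColors G σ
  three-colours⇒3≤numColors a b c a< b< c< ab ac bc =
    Unique⊆⇒length≤ (fplus G σ a ∷ fplus G σ b ∷ fplus G σ c ∷ []) colours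
      ((ab ∷ ac ∷ []) ∷ (bc ∷ []) ∷ [] ∷ [])
      (colour∈ a< ∷ colour∈ b< ∷ colour∈ c< ∷ [])

  numColors≤3 : ∀ p q r → (∀ x → x < nV G → fplus G σ x ≡ p ⊎ fplus G σ x ≡ q ⊎ fplus G σ x ≡ r) →
    numColors G σ ≤ 3
  numColors≤3 p q r among = Unique⊆⇒length≤ colours (p ∷ q ∷ r ∷ []) (deduplicate-! _≟_ _) (All.tabulate colour∈pqr)
    where
    ∈pqr : ∀ {z} → z ≡ p ⊎ z ≡ q ⊎ z ≡ r → z ∈ p ∷ q ∷ r ∷ []
    ∈pqr (inj₁ e)        = here e
    ∈pqr (inj₂ (inj₁ e)) = there (here e)
    ∈pqr (inj₂ (inj₂ e)) = there (there (here e))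
    colour∈pqr : ∀ {z} → z ∈ colours → z ∈ p ∷ q ∷ r ∷ []
    colour∈pqr z∈ with ∈-map⁻ (fplus G σ) (∈-deduplicate⁻ _≟_ _ z∈)
    ... | x , x∈ , refl = ∈pqr (among x (∈-upTo⁻ x∈))

edgeSum : ℕ → List (ℕ × ℕ) → List ℕ → ℕ
edgeSum y (e ∷ E) (w ∷ ws) = incid y e w + edgeSum y E ws
edgeSum y _       _        = 0

edgeSum-++ : ∀ y (E₁ E₂ : List (ℕ × ℕ)) (ws₁ ws₂ : List ℕ) → length E₁ ≡ length ws₁ →
             edgeSum y (E₁ ++ E₂) (ws₁ ++ ws₂) ≡ edgeSum y E₁ ws₁ + edgeSum y E₂ ws₂
edgeSum-++ y []      E₂ []       ws₂ _   = refl
edgeSum-++ y (e ∷ E₁) E₂ (w ∷ ws₁) ws₂ len =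
  trans (cong (incid y e w +_) (edgeSum-++ y E₁ E₂ ws₁ ws₂ (cong pred len))) (sym (+-assoc (incid y e w) _ _))

sum-tabulate-edgeSum : ∀ y (E : List (ℕ × ℕ)) (ws : List ℕ) .(len : length E ≡ length ws) →
  sum (tabulate (λ e → incid y (lookup E e) (lookup ws (cast len e)))) ≡ edgeSum y E ws
sum-tabulate-edgeSum y []      []       _   = refl
sum-tabulate-edgeSum y (e ∷ E) (w ∷ ws) len = cong (incid y e w +_) (sum-tabulate-edgeSum y E ws (cong pred len))

module ListLabeling (G : Graph) (ws : List ℕ) (len : nE G ≡ length ws)
                    (in-range : All (λ w → 1 ≤ w × w ≤ nE G) ws)
                    (covers : ∀ w → 1 ≤ w → w ≤ nE G → w ∈ ws) where

  private
    m : ℕ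
    m = nE G

    toFin : ∀ {w} → 1 ≤ w × w ≤ m → Fin m
    toFin {suc w} (_ , w<m) = fromℕ< w<m

    suc-toFin : ∀ {w} (r : 1 ≤ w × w ≤ m) → suc (toℕ (toFin r)) ≡ w
    suc-toFin {suc w} (_ , w<m) = cong suc (toℕ-fromℕ< w<m)

    labelOf : Fin m → ℕ
    labelOf e = lookup ws (cast len e)

    position : Fin m → Fin m
    position e = toFin (All.lookup in-range (∈-lookup (cast len e)))

    suc-position : ∀ e → suc (toℕ (position e)) ≡ labelOf e
    suc-position e = suc-toFin (All.lookup in-range (∈-lookup (cast len e)))

    position-onto : ∀ y → ∃ λ x → position x ≡ y
    position-onto y = x , toℕ-injective (cong pred same-label)
      where
      occurrence : suc (toℕ y) ∈ ws
      occurrence = covers (suc (toℕ y)) (s≤s z≤n) (toℕ<n y)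
      x : Fin m
      x = cast (sym len) (index occurrence)
      same-label : suc (toℕ (position x)) ≡ suc (toℕ y)
      same-label = trans (suc-position x)
        (trans (cong (lookup ws) (cast-involutive len (sym len) (index occurrence))) (sym (lookup-index occurrence)))

  σ : Labeling G
  σ = surjection⇒permutation position position-onto

  fplus≡edgeSum : ∀ y → fplus G σ y ≡ edgeSum y (edges G) ws
  fplus≡edgeSum y = trans (cong sum (trans (map-tabulate (λ e → e) _)
                                           (tabulate-cong (λ e → cong (incid y (edge G e)) (suc-position e)))))
                          (sum-tabulate-edgeSum y (edges G) ws len)

incid-miss : ∀ {y a b} w → y ≢ a → y ≢ b → incid y (a , b) w ≡ 0
incid-miss {y} {a} {b} w y≢a y≢b with y ≟ a | y ≟ b
... | yes y≡a | _       = ⊥-elim (y≢a y≡a)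
... | no _    | yes y≡b = ⊥-elim (y≢b y≡b)
... | no _    | no _    = refl

incid-hit₁ : ∀ {y a b} w → y ≡ a → incid y (a , b) w ≡ w
incid-hit₁ {y} {a} {b} w y≡a with y ≟ a
... | yes _   = refl
... | no y≢a  = ⊥-elim (y≢a y≡a)

incid-hit₂ : ∀ {y a b} w → y ≡ b → incid y (a , b) w ≡ w
incid-hit₂ {y} {a} {b} w y≡b with y ≟ a | y ≟ b
... | yes _ | _       = refl
... | no _  | yes _   = refl
... | no _  | no y≢b  = ⊥-elim (y≢b y≡b)

incid-forget₁ : ∀ {y a b} w → y ≢ a → incid y (a , b) w ≡ incid y (b , b) w
incid-forget₁ {y} {a} {b} w y≢a = by-cases (y ≟ b)
  where
  by-cases : Dec (y ≡ b) → incid y (a , b) w ≡ incid y (b , b) w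
  by-cases (yes y≡b) = trans (incid-hit₂ w y≡b) (sym (incid-hit₁ w y≡b))
  by-cases (no y≢b)  = trans (incid-miss w y≢a y≢b) (sym (incid-miss w y≢b y≢b))

alternate : ℕ → ℕ → ℕ → ℕ
alternate p q zero    = p
alternate p q (suc i) = alternate q p i

alternate-even : ∀ p q t → alternate p q (t + t) ≡ p
alternate-even p q zero    = refl
alternate-even p q (suc t) rewrite +-suc t t = alternate-even p q t

Alternating : ℕ → ℕ → List ℕ → Set
Alternating p q (w ∷ w′ ∷ ws) = (w + w′ ≡ p) × Alternating q p (w′ ∷ ws)
Alternating p q _             = ⊤

edgeSum-chain-away : ∀ {y} n w (R : List ℕ) → y ≢ 1 → y < n ⊎ n + length R < y →
                     edgeSum y (chain n (length R)) (w ∷ R) ≡ 0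
edgeSum-chain-away {y} n w []      y≢1 (inj₁ y<n) = cong (_+ 0) (incid-miss w (<⇒≢ y<n) y≢1)
edgeSum-chain-away {y} n w []      y≢1 (inj₂ n+0<y) =
  cong (_+ 0) (incid-miss w (≢-sym (<⇒≢ (subst (_< y) (+-identityʳ n) n+0<y))) y≢1)
edgeSum-chain-away {y} n w (r ∷ R) y≢1 (inj₁ y<n) =
  cong₂ _+_ (incid-miss w (<⇒≢ y<n) (<⇒≢ (m<n⇒m<1+n y<n)))
            (edgeSum-chain-away (suc n) r R y≢1 (inj₁ (m<n⇒m<1+n y<n)))
edgeSum-chain-away {y} n w (r ∷ R) y≢1 (inj₂ beyond) =
  cong₂ _+_ (incid-miss w (≢-sym (<⇒≢ (≤-<-trans (m≤m+n n _) beyond)))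
                          (≢-sym (<⇒≢ (≤-<-trans (subst (_≤ n + suc (length R)) (+-comm n 1) (+-monoʳ-≤ n (s≤s z≤n))) beyond))))
            (edgeSum-chain-away (suc n) r R y≢1 (inj₂ (subst (_< y) (+-suc n (length R)) beyond)))

lastOf : ℕ → List ℕ → ℕ
lastOf w []       = w
lastOf w (x ∷ xs) = lastOf x xs

edgeSum-chain-end : ∀ n w (R : List ℕ) → 2 ≤ n → edgeSum 1 (chain n (length R)) (w ∷ R) ≡ lastOf w R
edgeSum-chain-end n w []      _   = trans (cong (_+ 0) (incid-hit₂ w refl)) (+-identityʳ w)
edgeSum-chain-end n w (r ∷ R) 2≤n = trans (cong (_+ _) (incid-miss w (<⇒≢ 2≤n) (<⇒≢ (m<n⇒m<1+n 2≤n))))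
                                          (edgeSum-chain-end (suc n) r R (m≤n⇒m≤1+n 2≤n))

-- w is the label of the edge entering n; for the vertices n + i of the chain it acts like a loop at n.
edgeSum-chain-inside : ∀ n p q w w′ (R : List ℕ) → Alternating p q (w ∷ w′ ∷ R) → 2 ≤ n →
  ∀ i → i ≤ length R → incid (n + i) (n , n) w + edgeSum (n + i) (chain n (length R)) (w′ ∷ R) ≡ alternate p q i
edgeSum-chain-inside n p q w w′ [] (sum≡p , _) _ zero z≤n =
  trans (cong₂ _+_ (incid-hit₁ w (+-identityʳ n)) (cong (_+ 0) (incid-hit₁ w′ (+-identityʳ n))))
        (trans (cong (w +_) (+-identityʳ w′)) sum≡p)
edgeSum-chain-inside n p q w w′ (r ∷ R) (sum≡p , _) 2≤n zero z≤n =
  trans (cong₂ _+_ (incid-hit₁ w (+-identityʳ n))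
          (cong₂ _+_ (incid-hit₁ w′ (+-identityʳ n))
                     (trans (cong (λ z → edgeSum z (chain (suc n) (length R)) (r ∷ R)) (+-identityʳ n))
                            (edgeSum-chain-away (suc n) r R (≢-sym (<⇒≢ 2≤n)) (inj₁ (n<1+n n))))))
        (trans (cong (w +_) (+-identityʳ w′)) sum≡p)
edgeSum-chain-inside n p q w w′ (r ∷ R) (_ , alt) 2≤n (suc i) (s≤s i≤) =
  trans (cong₂ _+_ (incid-miss w n+1+i≢n n+1+i≢n)
          (cong₂ _+_ (shift w′) (cong (λ z → edgeSum z (chain (suc n) (length R)) (r ∷ R)) (+-suc n i))))
        (edgeSum-chain-inside (suc n) q p w′ r R alt (m≤n⇒m≤1+n 2≤n) i i≤)
  where
  n+1+i≢n : n + suc i ≢ n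
  n+1+i≢n = ≢-sym (<⇒≢ (subst (n <_) (sym (+-suc n i)) (s≤s (m≤m+n n i))))
  shift : ∀ v → incid (n + suc i) (n , suc n) v ≡ incid (suc n + i) (suc n , suc n) v
  shift v = trans (incid-forget₁ v n+1+i≢n) (cong (λ z → incid z (suc n , suc n) v) (+-suc n i))

-- Labels (w , w′ , R) of a (u,v)-path of length 2 + length R, listed from u: w is on the edge at u.
PathLabels : Set
PathLabels = ℕ × ℕ × List ℕ

pathLabels : PathLabels → List ℕ
pathLabels (w , w′ , R) = w ∷ w′ ∷ R

pathLengths : List PathLabels → List ℕ
pathLengths = map (λ p → length (pathLabels p))

allLabels : List PathLabels → List ℕ
allLabels = concatMap pathLabels

innerSum : List ℕ → ℕ
innerSum as = sum (map (_∸ 1) as)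

innerCount : List PathLabels → ℕ
innerCount Ps = innerSum (pathLengths Ps)

thetaSum : ℕ → List PathLabels → ℕ → ℕ
thetaSum n Ps y = edgeSum y (thetaEdges n (pathLengths Ps)) (allLabels Ps)

uSum : List PathLabels → ℕ
uSum Ps = sum (map proj₁ Ps)

lastLabel : PathLabels → ℕ
lastLabel (_ , w′ , R) = lastOf w′ R

vSum : List PathLabels → ℕ
vSum Ps = sum (map lastLabel Ps)

length-chain : ∀ n k → length (chain n k) ≡ suc k
length-chain n zero    = refl
length-chain n (suc k) = cong suc (length-chain (suc n) k)

length-thetaEdges : ∀ n Ps → length (thetaEdges n (pathLengths Ps)) ≡ length (allLabels Ps)
length-thetaEdges n []                  = refl
length-thetaEdges n ((w , w′ , R) ∷ Ps) =
  trans (length-++ (pathEdges n (suc (suc (length R)))))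
        (trans (cong₂ _+_ (cong suc (length-chain n (length R))) (length-thetaEdges _ Ps))
               (sym (length-++ (w ∷ w′ ∷ R))))

length-allLabels : ∀ Ps → length (allLabels Ps) ≡ sum (pathLengths Ps)
length-allLabels []       = refl
length-allLabels (p ∷ Ps) = trans (length-++ (pathLabels p)) (cong (length (pathLabels p) +_) (length-allLabels Ps))

innerSum-++ : ∀ as bs → innerSum (as ++ bs) ≡ innerSum as + innerSum bs
innerSum-++ as bs = trans (cong sum (map-++ (_∸ 1) as bs)) (sum-++ (map (_∸ 1) as) _)

thetaEdges-++ : ∀ n as bs → thetaEdges n (as ++ bs) ≡ thetaEdges n as ++ thetaEdges (n + innerSum as) bs
thetaEdges-++ n []       bs = cong (λ m → thetaEdges m bs) (sym (+-identityʳ n))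
thetaEdges-++ n (a ∷ as) bs =
  trans (cong (pathEdges n a ++_)
              (trans (thetaEdges-++ (n + (a ∸ 1)) as bs)
                     (cong (λ m → thetaEdges (n + (a ∸ 1)) as ++ thetaEdges m bs) (+-assoc n (a ∸ 1) (innerSum as)))))
        (sym (++-assoc (pathEdges n a) _ _))

uSum-++ : ∀ Ps Qs → uSum (Ps ++ Qs) ≡ uSum Ps + uSum Qs
uSum-++ Ps Qs = trans (cong sum (map-++ proj₁ Ps Qs)) (sum-++ (map proj₁ Ps) _)

vSum-++ : ∀ Ps Qs → vSum (Ps ++ Qs) ≡ vSum Ps + vSum Qs
vSum-++ Ps Qs = trans (cong sum (map-++ lastLabel Ps Qs)) (sum-++ (map lastLabel Ps) _)

thetaSum-∷ : ∀ n (w w′ : ℕ) R Ps y →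
  thetaSum n ((w , w′ , R) ∷ Ps) y ≡
  edgeSum y (pathEdges n (suc (suc (length R)))) (w ∷ w′ ∷ R) + thetaSum (n + suc (length R)) Ps y
thetaSum-∷ n w w′ R Ps y =
  edgeSum-++ y (pathEdges n (suc (suc (length R)))) _ (w ∷ w′ ∷ R) _ (cong suc (length-chain n (length R)))

module PathSum (n : ℕ) (w w′ : ℕ) (R : List ℕ) (2≤n : 2 ≤ n) where

  pathSum : ℕ → ℕ
  pathSum y = edgeSum y (pathEdges n (suc (suc (length R)))) (w ∷ w′ ∷ R)

  pathSum-u : pathSum 0 ≡ w
  pathSum-u = trans (cong₂ _+_ (incid-hit₁ {0} {0} {n} w refl)
                               (edgeSum-chain-away n w′ R (λ ()) (inj₁ (≤-trans (s≤s z≤n) 2≤n))))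
                    (+-identityʳ w)

  pathSum-v : pathSum 1 ≡ lastOf w′ R
  pathSum-v = cong₂ _+_ (incid-miss w (λ ()) (<⇒≢ 2≤n)) (edgeSum-chain-end n w′ R 2≤n)

  pathSum-away : ∀ y → y ≢ 0 → y ≢ 1 → y < n ⊎ n + length R < y → pathSum y ≡ 0
  pathSum-away y y≢0 y≢1 away = cong₂ _+_ (incid-miss w y≢0 (y≢n away)) (edgeSum-chain-away n w′ R y≢1 away)
    where
    y≢n : y < n ⊎ n + length R < y → y ≢ n
    y≢n (inj₁ y<n)    = <⇒≢ y<n
    y≢n (inj₂ beyond) = ≢-sym (<⇒≢ (≤-<-trans (m≤m+n n _) beyond))

  pathSum-inside : ∀ p q → Alternating p q (w ∷ w′ ∷ R) → ∀ i → i ≤ length R → pathSum (n + i) ≡ alternate p q i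
  pathSum-inside p q alt i i≤ =
    trans (cong (_+ _) (incid-forget₁ w (≢-sym (<⇒≢ (≤-trans (s≤s z≤n) (≤-trans 2≤n (m≤m+n n i)))))))
          (edgeSum-chain-inside n p q w w′ R alt 2≤n i i≤)

open PathSum

thetaSum-u : ∀ n Ps → 2 ≤ n → thetaSum n Ps 0 ≡ uSum Ps
thetaSum-u n []                  _   = refl
thetaSum-u n ((w , w′ , R) ∷ Ps) 2≤n =
  trans (thetaSum-∷ n w w′ R Ps 0) (cong₂ _+_ (pathSum-u n w w′ R 2≤n) (thetaSum-u _ Ps (≤-trans 2≤n (m≤m+n n _))))

thetaSum-v : ∀ n Ps → 2 ≤ n → thetaSum n Ps 1 ≡ vSum Ps
thetaSum-v n []                  _   = refl
thetaSum-v n ((w , w′ , R) ∷ Ps) 2≤n =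
  trans (thetaSum-∷ n w w′ R Ps 1) (cong₂ _+_ (pathSum-v n w w′ R 2≤n) (thetaSum-v _ Ps (≤-trans 2≤n (m≤m+n n _))))

thetaSum-below : ∀ n Ps y → 2 ≤ y → y < n → thetaSum n Ps y ≡ 0
thetaSum-below n []                  y _   _   = refl
thetaSum-below n ((w , w′ , R) ∷ Ps) y 2≤y y<n =
  trans (thetaSum-∷ n w w′ R Ps y)
        (cong₂ _+_ (pathSum-away n w w′ R (≤-trans 2≤y (<⇒≤ y<n)) y (≢-sym (<⇒≢ (≤-trans (s≤s z≤n) 2≤y)))
                                 (≢-sym (<⇒≢ 2≤y)) (inj₁ y<n))
                   (thetaSum-below _ Ps y 2≤y (<-≤-trans y<n (m≤m+n n _))))

thetaSum-first-path : ∀ n w w′ R Ps p q → 2 ≤ n → Alternating p q (w ∷ w′ ∷ R) → ∀ i → i ≤ length R →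
                      thetaSum n ((w , w′ , R) ∷ Ps) (n + i) ≡ alternate p q i
thetaSum-first-path n w w′ R Ps p q 2≤n alt i i≤ =
  trans (thetaSum-∷ n w w′ R Ps (n + i))
        (trans (cong₂ _+_ (pathSum-inside n w w′ R 2≤n p q alt i i≤)
                          (thetaSum-below _ Ps (n + i) (≤-trans 2≤n (m≤m+n n i)) (+-monoʳ-< n (s≤s i≤))))
               (+-identityʳ _))

Proper : (ℕ → ℕ) → List (ℕ × ℕ) → Set
Proper V E = All (λ e → V (proj₁ e) ≢ V (proj₂ e)) E

chain-proper : ∀ (V : ℕ → ℕ) n p q (R : List ℕ) → p ≢ q → V 1 ≢ p → V 1 ≢ q →
  (∀ i → i ≤ length R → V (n + i) ≡ alternate p q i) → Proper V (chain n (length R))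
chain-proper V n p q []      _   V1≢p _    V≡ = (λ e → V1≢p (trans (sym e) (V-start V≡))) ∷ []
  where
  V-start : (∀ i → i ≤ 0 → V (n + i) ≡ alternate p q i) → V n ≡ p
  V-start V≡ = trans (cong V (sym (+-identityʳ n))) (V≡ 0 z≤n)
chain-proper V n p q (r ∷ R) p≢q V1≢p V1≢q V≡ =
  (λ e → p≢q (trans (sym Vn≡p) (trans e Vn+1≡q)))
  ∷ chain-proper V (suc n) q p R (≢-sym p≢q) V1≢q V1≢p
      (λ i i≤ → trans (cong V (sym (+-suc n i))) (V≡ (suc i) (s≤s i≤)))
  where
  Vn≡p : V n ≡ p
  Vn≡p = trans (cong V (sym (+-identityʳ n))) (V≡ 0 z≤n)
  Vn+1≡q : V (suc n) ≡ q
  Vn+1≡q = trans (cong V (trans (sym (cong suc (+-identityʳ n))) (sym (+-suc n 0)))) (V≡ 1 (s≤s z≤n))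

module TwoValued (M₁ M₂ : ℕ) (M₁≢M₂ : M₁ ≢ M₂) where

  OneOf : ℕ → Set
  OneOf v = v ≡ M₁ ⊎ v ≡ M₂

  NeitherOf : ℕ → Set
  NeitherOf v = v ≢ M₁ × v ≢ M₂

  Alternates : PathLabels → Set
  Alternates p = Alternating M₁ M₂ (pathLabels p) ⊎ Alternating M₂ M₁ (pathLabels p)

  alternate-OneOf : ∀ i → OneOf (alternate M₁ M₂ i) × OneOf (alternate M₂ M₁ i)
  alternate-OneOf zero    = inj₁ refl , inj₂ refl
  alternate-OneOf (suc i) = proj₂ (alternate-OneOf i) , proj₁ (alternate-OneOf i)

  thetaSum-inner-OneOf : ∀ n Ps → 2 ≤ n → All Alternates Ps →
                         ∀ y → n ≤ y → y < n + innerCount Ps → OneOf (thetaSum n Ps y)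
  thetaSum-inner-OneOf n [] _ _ y n≤y y< = ⊥-elim (<⇒≱ y< (subst (_≤ y) (sym (+-identityʳ n)) n≤y))
  thetaSum-inner-OneOf n ((w , w′ , R) ∷ Ps) 2≤n (alt ∷ alts) y n≤y y< with y <? n + suc (length R)
  ... | yes on-path = subst (λ z → OneOf (thetaSum n ((w , w′ , R) ∷ Ps) z)) (m+[n∸m]≡n n≤y) (by-orientation alt)
    where
    i : ℕ
    i = y ∸ n
    i≤ : i ≤ length R
    i≤ = s≤s⁻¹ (+-cancelˡ-≤ n _ _ (subst (_≤ n + suc (length R))
                                        (trans (cong suc (sym (m+[n∸m]≡n n≤y))) (sym (+-suc n i))) on-path))
    by-orientation : Alternates (w , w′ , R) → OneOf (thetaSum n ((w , w′ , R) ∷ Ps) (n + i))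
    by-orientation (inj₁ a) = subst OneOf (sym (thetaSum-first-path n w w′ R Ps M₁ M₂ 2≤n a i i≤)) (proj₁ (alternate-OneOf i))
    by-orientation (inj₂ a) = subst OneOf (sym (thetaSum-first-path n w w′ R Ps M₂ M₁ 2≤n a i i≤)) (proj₂ (alternate-OneOf i))
  ... | no off-path = subst OneOf (sym (trans (thetaSum-∷ n w w′ R Ps y) (cong (_+ thetaSum (n + suc (length R)) Ps y) first-path≡0)))
                                  (thetaSum-inner-OneOf (n + suc (length R)) Ps (≤-trans 2≤n (m≤m+n n _)) alts y (≮⇒≥ off-path)
                                                        (subst (y <_) (sym (+-assoc n (suc (length R)) (innerCount Ps))) y<))
    where
    first-path≡0 : pathSum n w w′ R 2≤n y ≡ 0
    first-path≡0 = pathSum-away n w w′ R 2≤n y (≢-sym (<⇒≢ (≤-trans (s≤s z≤n) (≤-trans 2≤n n≤y))))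
                                             (≢-sym (<⇒≢ (≤-trans 2≤n n≤y)))
                                             (inj₂ (subst (_≤ y) (+-suc n (length R)) (≮⇒≥ off-path)))

  thetaEdges-proper : ∀ (V : ℕ → ℕ) n Ps → 2 ≤ n → All Alternates Ps → NeitherOf (V 0) → NeitherOf (V 1) →
                      (∀ y → n ≤ y → y < n + innerCount Ps → V y ≡ thetaSum n Ps y) →
                      Proper V (thetaEdges n (pathLengths Ps))
  thetaEdges-proper V n [] _ _ _ _ _ = []
  thetaEdges-proper V n ((w , w′ , R) ∷ Ps) 2≤n (alt ∷ alts) V0∉ V1∉ V≡ = ++⁺ (first-path alt) rest
    where
    n′ : ℕ
    n′ = n + suc (length R)
    on-path : ∀ p q → p ≢ q → V 0 ≢ p → V 1 ≢ p → V 1 ≢ q → Alternating p q (w ∷ w′ ∷ R) →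
              Proper V (pathEdges n (suc (suc (length R))))
    on-path p q p≢q V0≢p V1≢p V1≢q a =
      (λ e → V0≢p (trans e (trans (cong V (sym (+-identityʳ n))) (V-inside 0 z≤n))))
      ∷ chain-proper V n p q R p≢q V1≢p V1≢q V-inside
      where
      V-inside : ∀ i → i ≤ length R → V (n + i) ≡ alternate p q i
      V-inside i i≤ = trans (V≡ (n + i) (m≤m+n n i) (+-monoʳ-< n (s≤s (≤-trans i≤ (m≤m+n (length R) _)))))
                            (thetaSum-first-path n w w′ R Ps p q 2≤n a i i≤)
    first-path : Alternates (w , w′ , R) → Proper V (pathEdges n (suc (suc (length R))))
    first-path (inj₁ a) = on-path M₁ M₂ M₁≢M₂ (proj₁ V0∉) (proj₁ V1∉) (proj₂ V1∉) a
    first-path (inj₂ a) = on-path M₂ M₁ (≢-sym M₁≢M₂) (proj₂ V0∉) (proj₂ V1∉) (proj₁ V1∉) a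
    rest : Proper V (thetaEdges n′ (pathLengths Ps))
    rest = thetaEdges-proper V n′ Ps (≤-trans 2≤n (m≤m+n n _)) alts V0∉ V1∉ V≡′
      where
      V≡′ : ∀ y → n′ ≤ y → y < n′ + innerCount Ps → V y ≡ thetaSum n′ Ps y
      V≡′ y n′≤y y< =
        trans (V≡ y (≤-trans (m≤m+n n _) n′≤y) (subst (y <_) (+-assoc n _ (innerCount Ps)) y<))
              (trans (thetaSum-∷ n w w′ R Ps y)
                     (cong (_+ thetaSum n′ Ps y)
                           (pathSum-away n w w′ R 2≤n y
                             (≢-sym (<⇒≢ (≤-trans (s≤s z≤n) (≤-trans 2≤n (≤-trans (m≤m+n n _) n′≤y)))))
                             (≢-sym (<⇒≢ (≤-trans 2≤n (≤-trans (m≤m+n n _) n′≤y))))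
                             (inj₂ (subst (_≤ y) (+-suc n (length R)) n′≤y)))))

localAntimagic⇒Proper : ∀ G σ → IsLocalAntimagic G σ → Proper (fplus G σ) (edges G)
localAntimagic⇒Proper G σ la =
  All.tabulate (λ e∈ → subst (λ e → fplus G σ (proj₁ e) ≢ fplus G σ (proj₂ e)) (sym (lookup-index e∈)) (la (index e∈)))

Proper⇒localAntimagic : ∀ G σ → Proper (fplus G σ) (edges G) → IsLocalAntimagic G σ
Proper⇒localAntimagic G σ proper e = All.lookup proper (∈-lookup e)

module TwoValueWalk (V : ℕ → ℕ) (P Q : ℕ) where

  ThirdValueUpTo : ℕ → Set
  ThirdValueUpTo bound = Σ ℕ λ y → (y ≡ 1 ⊎ y ≤ bound) × V y ≢ P × V y ≢ Q

  private
    classify : ∀ y → (V y ≡ P ⊎ V y ≡ Q) ⊎ (V y ≢ P × V y ≢ Q)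
    classify y with V y ≟ P | V y ≟ Q
    ... | yes y≡P | _       = inj₁ (inj₁ y≡P)
    ... | no _    | yes y≡Q = inj₁ (inj₂ y≡Q)
    ... | no y≢P  | no y≢Q  = inj₂ (y≢P , y≢Q)

    other : ∀ j x → x ≡ P ⊎ x ≡ Q → x ≢ alternate P Q j → x ≡ alternate P Q (suc j)
    other j x x∈ x≢ = go P Q j x∈ x≢
      where
      go : ∀ p q j → x ≡ p ⊎ x ≡ q → x ≢ alternate p q j → x ≡ alternate p q (suc j)
      go p q zero    (inj₁ x≡p) x≢p = ⊥-elim (x≢p x≡p)
      go p q zero    (inj₂ x≡q) _   = x≡q
      go p q (suc j) (inj₁ x≡p) x≢  = go q p j (inj₂ x≡p) x≢
      go p q (suc j) (inj₂ x≡q) x≢  = go q p j (inj₁ x≡q) x≢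

  walk-chain : ∀ k n j → Proper V (chain n k) → V n ≡ alternate P Q j →
               ThirdValueUpTo (n + k) ⊎ V 1 ≡ alternate P Q (k + suc j)
  walk-chain zero n j (n≢1 ∷ []) Vn≡ with classify 1
  ... | inj₂ third = inj₁ (1 , inj₁ refl , third)
  ... | inj₁ two   = inj₂ (other j (V 1) two (λ e → n≢1 (trans Vn≡ (sym e))))
  walk-chain (suc k) n j (n≢n+1 ∷ proper) Vn≡ with classify (suc n)
  ... | inj₂ third = inj₁ (suc n , inj₂ (subst (suc n ≤_) (sym (+-suc n k)) (s≤s (m≤m+n n k))) , third)
  ... | inj₁ two with walk-chain k (suc n) (suc j) proper (other j (V (suc n)) two (λ e → n≢n+1 (trans Vn≡ (sym e))))
  ...   | inj₁ (y , y∈ , third) = inj₁ (y , widen y∈ , third)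
    where
    widen : y ≡ 1 ⊎ y ≤ suc n + k → y ≡ 1 ⊎ y ≤ n + suc k
    widen (inj₁ y≡1) = inj₁ y≡1
    widen (inj₂ y≤)  = inj₂ (subst (y ≤_) (sym (+-suc n k)) y≤)
  ...   | inj₂ V1≡ = inj₂ (trans V1≡ (cong (alternate P Q) (+-suc k (suc j))))

  walk-path : ∀ k n → Proper V (pathEdges n (suc (suc k))) → V 0 ≡ P →
              ThirdValueUpTo (n + k) ⊎ V 1 ≡ alternate P Q (k + 2)
  walk-path k n (u≢n ∷ proper) V0≡P with classify n
  ... | inj₂ third = inj₁ (n , inj₂ (m≤m+n n k) , third)
  ... | inj₁ two   = walk-chain k n 1 proper (other 0 (V n) two (λ e → u≢n (trans V0≡P (sym e))))

-- u, its neighbour on the even path and a vertex of a third value are three distinct colours; if no third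
-- value occurred, walking from u to v along the even path and along the odd path would end in different values.
theta-mixed-parity⇒3≤numColors : ∀ t t′ xs ys →
  let G = theta ((2 + (t + t)) ∷ xs ++ (2 + suc (t′ + t′)) ∷ ys) in
  (σ : Labeling G) → IsLocalAntimagic G σ → 3 ≤ numColors G σ
theta-mixed-parity⇒3≤numColors t t′ xs ys σ la =
  conclude (walk-path (t + t) 2 even-path refl) (walk-path (suc (t′ + t′)) n₃ odd-path refl)
  where
  G : Graph
  G = theta ((2 + (t + t)) ∷ xs ++ (2 + suc (t′ + t′)) ∷ ys)
  V : ℕ → ℕ
  V = fplus G σ
  n₁ n₃ : ℕ
  n₁ = 2 + suc (t + t)
  n₃ = n₁ + innerSum xs
  proper : Proper V (edges G)
  proper = localAntimagic⇒Proper G σ la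
  even-path : Proper V (pathEdges 2 (2 + (t + t)))
  even-path = ++⁻ˡ (pathEdges 2 (2 + (t + t))) proper
  odd-path : Proper V (pathEdges n₃ (2 + suc (t′ + t′)))
  odd-path = ++⁻ˡ (pathEdges n₃ (2 + suc (t′ + t′))) (++⁻ʳ (thetaEdges n₁ xs)
               (subst (Proper V) (thetaEdges-++ n₁ xs _) (++⁻ʳ (pathEdges 2 (2 + (t + t))) proper)))
  P Q : ℕ
  P = V 0
  Q = V 2
  P≢Q : P ≢ Q
  P≢Q = All.head even-path
  open TwoValueWalk V P Q
  third-value : ∀ {bound} → (∀ y → y ≡ 1 ⊎ y ≤ bound → y < nV G) → ThirdValueUpTo bound → 3 ≤ numColors G σ
  third-value inside (y , y∈ , y≢P , y≢Q) =
    three-colours⇒3≤numColors G σ 0 2 y (s≤s z≤n) (s≤s (s≤s (s≤s z≤n))) (inside y y∈) P≢Q (≢-sym y≢P) (≢-sym y≢Q)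
  inside-even : ∀ y → y ≡ 1 ⊎ y ≤ 2 + (t + t) → y < nV G
  inside-even _ (inj₁ refl) = s≤s (s≤s z≤n)
  inside-even y (inj₂ y≤)   = ≤-trans (s≤s y≤) (s≤s (s≤s (m≤m+n (suc (t + t)) _)))
  inside-odd : ∀ y → y ≡ 1 ⊎ y ≤ n₃ + suc (t′ + t′) → y < nV G
  inside-odd _ (inj₁ refl) = s≤s (s≤s z≤n)
  inside-odd y (inj₂ y≤)   = ≤-trans (s≤s y≤) (≤-trans (m≤m+n _ (innerSum ys)) (≤-reflexive count))
    where
    count : suc (n₃ + suc (t′ + t′)) + innerSum ys ≡ nV G
    count = trans (layout (suc (t + t)) (innerSum xs) (suc (t′ + t′)) (innerSum ys))
                  (cong (λ m → 2 + (suc (t + t) + m)) (sym (innerSum-++ xs _)))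
      where
      layout : ∀ a X k Y → suc ((2 + a + X) + k) + Y ≡ 2 + (a + (X + (suc k + Y)))
      layout = solve-∀
  conclude : ThirdValueUpTo (2 + (t + t)) ⊎ V 1 ≡ alternate P Q (t + t + 2) →
             ThirdValueUpTo (n₃ + suc (t′ + t′)) ⊎ V 1 ≡ alternate P Q (suc (t′ + t′) + 2) →
             3 ≤ numColors G σ
  conclude (inj₁ third) _             = third-value inside-even third
  conclude (inj₂ _)     (inj₁ third)  = third-value inside-odd third
  conclude (inj₂ V1≡P′) (inj₂ V1≡Q′) = ⊥-elim (P≢Q (trans (sym even-end) (trans (sym V1≡P′) (trans V1≡Q′ odd-end))))
    where
    twice-suc : ∀ m → m + m + 2 ≡ suc m + suc m
    twice-suc = solve-∀
    even-end : alternate P Q (t + t + 2) ≡ P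
    even-end = trans (cong (alternate P Q) (twice-suc t)) (alternate-even P Q (suc t))
    odd-end : alternate P Q (suc (t′ + t′) + 2) ≡ Q
    odd-end = trans (cong (alternate Q P) (twice-suc t′)) (alternate-even Q P (suc t′))

replicate-+ : ∀ {A : Set} m n (a : A) → replicate (m + n) a ≡ replicate m a ++ replicate n a
replicate-+ zero    n a = refl
replicate-+ (suc m) n a = cong (a ∷_) (replicate-+ m n a)

series : (ℕ → ℕ → PathLabels) → ℕ → ℕ → ℕ → List PathLabels
series p x y zero    = []
series p x y (suc k) = p x (y + k) ∷ series p (suc x) y k

∈-allLabels : ∀ {w p Ps} → w ∈ pathLabels p → p ∈ Ps → w ∈ allLabels Ps
∈-allLabels w∈p p∈Ps = ∈-concat⁺′ w∈p (∈-map⁺ pathLabels p∈Ps)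

All-allLabels : ∀ {P : ℕ → Set} {Ps} → All (λ p → All P (pathLabels p)) Ps → All P (allLabels Ps)
All-allLabels all = concat⁺ (map⁺ all)

private
  peel-sum : ∀ x y k {C} → x + (y + suc k) ≡ suc C → x + (y + k) ≡ C
  peel-sum x y k e = suc-injective (trans (sym (+-suc x (y + k))) (trans (cong (x +_) (sym (+-suc y k))) e))

series-All : ∀ (Q : PathLabels → Set) p C k x y → x + (y + k) ≡ suc C →
             (∀ a b → x ≤ a → a < x + k → a + b ≡ C → Q (p a b)) → All Q (series p x y k)
series-All Q p C zero    x y _   _     = []
series-All Q p C (suc k) x y sum≡ holds =
  holds x (y + k) ≤-refl (m<m+n x (s≤s z≤n)) (peel-sum x y k sum≡)
  ∷ series-All Q p C k (suc x) y (cong suc (peel-sum x y k sum≡))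
      (λ a b x<a a< → holds a b (<⇒≤ x<a) (subst (a <_) (sym (+-suc x k)) a<))

series-∋ : ∀ p C k x y a b → x + (y + k) ≡ suc C → x ≤ a → a < x + k → a + b ≡ C → p a b ∈ series p x y k
series-∋ p C zero    x y a b _    x≤a a<x+0 _ = ⊥-elim (<⇒≱ a<x+0 (subst (_≤ a) (sym (+-identityʳ x)) x≤a))
series-∋ p C (suc k) x y a b sum≡ x≤a a<    a+b≡C with m≤n⇒m<n∨m≡n x≤a
... | inj₂ refl = here (cong (p x) (+-cancelˡ-≡ x b (y + k) (trans a+b≡C (sym (peel-sum x y k sum≡)))))
... | inj₁ x<a  = there (series-∋ p C k (suc x) y a b (cong suc (peel-sum x y k sum≡)) x<a (subst (a <_) (+-suc x k) a<) a+b≡C)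

series-∋′ : ∀ p C k x y a b → x + (y + k) ≡ suc C → y ≤ b → b < y + k → a + b ≡ C → p a b ∈ series p x y k
series-∋′ p C zero    x y a b _    y≤b b<y+0 _ = ⊥-elim (<⇒≱ b<y+0 (subst (_≤ b) (sym (+-identityʳ y)) y≤b))
series-∋′ p C (suc k) x y a b sum≡ y≤b b<    a+b≡C with m≤n⇒m<n∨m≡n (s≤s⁻¹ (subst (b <_) (+-suc y k) b<))
... | inj₂ refl = here (cong (λ a → p a (y + k)) (+-cancelʳ-≡ (y + k) a x (trans a+b≡C (sym (peel-sum x y k sum≡)))))
... | inj₁ b<   = there (series-∋′ p C k (suc x) y a b (cong suc (peel-sum x y k sum≡)) y≤b b< a+b≡C)

module Construction (L : ℕ) where

  l s K M : ℕ
  l = suc L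
  s = 4 * l + 2
  K = 2 * L + 1
  M = 4 * l * s + l + 1

  -- D x′ and top x are the labels paired with x′ and x on the descending and odd paths.
  D₀ : ℕ
  D₀ = 2 * l * s + l + 1

  D : ℕ → ℕ
  D x′ = D₀ + x′

  top : ℕ → ℕ
  top x = x + 2 * l * s

  -- a, (k-1)s + b, a + s, (k-2)s + b, …, a + (k-1)s, b: consecutive sums alternate between c and c + s.
  zigzag : ℕ → ℕ → ℕ → List ℕ
  zigzag a b zero    = []
  zigzag a b (suc k) = a ∷ (k * s + b) ∷ zigzag (a + s) b k

  -- The labels of the four kinds of paths, listed from u; the parameters satisfy x + x′ = s.
  evenLow evenHigh oddHigh : ℕ → ℕ → PathLabels
  evenLow  x x′ = x , K * s + D x′ , zigzag (x + s) (D x′) K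
  evenHigh x x′ = D x′ , K * s + x , zigzag (D x′ + s) x K
  oddHigh  x x′ = top x , D x′ , (K * s + x) ∷ zigzag (D x′ + s) x K

  oddLow : PathLabels
  oddLow = 1 , K * s + D (4 * l + 1) , zigzag (1 + s) (D (4 * l + 1)) K ++ top 1 ∷ []

  block₁ block₂ block₃ blockOdd labelledPaths : List PathLabels
  block₁   = series evenLow (l + 1) (2 * l + 2) l
  block₂   = series evenHigh (2 * l + 1) l (l + 2)
  block₃   = series evenLow (3 * l + 3) 0 l
  blockOdd = oddLow ∷ series oddHigh 2 (3 * l + 2) L
  labelledPaths = block₁ ++ block₂ ++ block₃ ++ blockOdd

  -- In each block the parameters of the paths satisfy a + b = s.
  block₁-layout : (l + 1) + ((2 * l + 2) + l) ≡ suc s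
  block₁-layout = layout L
    where
    layout : ∀ n → (suc n + 1) + ((2 * suc n + 2) + suc n) ≡ suc (4 * suc n + 2)
    layout = solve-∀

  block₂-layout : (2 * l + 1) + (l + (l + 2)) ≡ suc s
  block₂-layout = layout L
    where
    layout : ∀ n → (2 * suc n + 1) + (suc n + (suc n + 2)) ≡ suc (4 * suc n + 2)
    layout = solve-∀

  block₃-layout : (3 * l + 3) + (0 + l) ≡ suc s
  block₃-layout = layout L
    where
    layout : ∀ n → (3 * suc n + 3) + (0 + suc n) ≡ suc (4 * suc n + 2)
    layout = solve-∀

  blockOdd-layout : 2 + ((3 * l + 2) + L) ≡ suc s
  blockOdd-layout = layout L
    where
    layout : ∀ n → 2 + ((3 * suc n + 2) + n) ≡ suc (4 * suc n + 2)
    layout = solve-∀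

  length-zigzag : ∀ a b k → length (zigzag a b k) ≡ k + k
  length-zigzag a b zero    = refl
  length-zigzag a b (suc k) = cong suc (trans (cong suc (length-zigzag (a + s) b k)) (sym (+-suc k k)))

  private
    even-length : ∀ n → suc (suc ((2 * n + 1) + (2 * n + 1))) ≡ 4 * suc n
    even-length = solve-∀
    odd-length : ∀ n → suc (suc ((2 * n + 1) + (2 * n + 1) + 1)) ≡ 4 * suc n + 1
    odd-length = solve-∀
    odd-length′ : ∀ n → suc (suc (suc ((2 * n + 1) + (2 * n + 1)))) ≡ 4 * suc n + 1
    odd-length′ = solve-∀

  length-evenLow : ∀ x x′ → length (pathLabels (evenLow x x′)) ≡ 4 * l
  length-evenLow x x′ = trans (cong (λ k → suc (suc k)) (length-zigzag (x + s) (D x′) K)) (even-length L)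

  length-evenHigh : ∀ x x′ → length (pathLabels (evenHigh x x′)) ≡ 4 * l
  length-evenHigh x x′ = trans (cong (λ k → suc (suc k)) (length-zigzag (D x′ + s) x K)) (even-length L)

  length-oddLow : length (pathLabels oddLow) ≡ 4 * l + 1
  length-oddLow = trans (cong (λ k → suc (suc k)) (trans (length-++ (zigzag (1 + s) (D (4 * l + 1)) K))
                                                         (cong (_+ 1) (length-zigzag _ _ K))))
                        (odd-length L)

  length-oddHigh : ∀ x x′ → length (pathLabels (oddHigh x x′)) ≡ 4 * l + 1
  length-oddHigh x x′ = trans (cong (λ k → suc (suc (suc k))) (length-zigzag (D x′ + s) x K)) (odd-length′ L)

  pathLengths-series : ∀ p a → (∀ x x′ → length (pathLabels (p x x′)) ≡ a) →
                       ∀ x y k → pathLengths (series p x y k) ≡ replicate k a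
  pathLengths-series p a len x y zero    = refl
  pathLengths-series p a len x y (suc k) = cong₂ _∷_ (len x (y + k)) (pathLengths-series p a len (suc x) y k)

  pathLengths-labelledPaths : pathLengths labelledPaths ≡ replicate (3 * l + 2) (4 * l) ++ replicate l (4 * l + 1)
  pathLengths-labelledPaths = begin
    pathLengths labelledPaths
      ≡⟨ by-blocks ⟩
    pathLengths block₁ ++ pathLengths block₂ ++ pathLengths block₃ ++ pathLengths blockOdd
      ≡⟨ cong₂ _++_ (evens-series evenLow length-evenLow (l + 1) (2 * l + 2) l)
                    (cong₂ _++_ (evens-series evenHigh length-evenHigh (2 * l + 1) l (l + 2))
                                (cong₂ _++_ (evens-series evenLow length-evenLow (3 * l + 3) 0 l)
                                            (cong₂ _∷_ length-oddLow (pathLengths-series oddHigh _ length-oddHigh 2 (3 * l + 2) L)))) ⟩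
    evens l ++ evens (l + 2) ++ evens l ++ odds
      ≡⟨ sym regroup ⟩
    evens (l + ((l + 2) + l)) ++ odds
      ≡⟨ cong (λ k → evens k ++ odds) (three-blocks L) ⟨
    evens (3 * l + 2) ++ odds ∎
    where
    open ≡-Reasoning
    evens : ℕ → List ℕ
    evens k = replicate k (4 * l)
    odds : List ℕ
    odds = replicate l (4 * l + 1)
    evens-series : ∀ p → (∀ x x′ → length (pathLabels (p x x′)) ≡ 4 * l) → ∀ x y k → pathLengths (series p x y k) ≡ evens k
    evens-series p = pathLengths-series p (4 * l)
    by-blocks : pathLengths labelledPaths ≡ pathLengths block₁ ++ pathLengths block₂ ++ pathLengths block₃ ++ pathLengths blockOdd
    by-blocks = trans (map-++ _ block₁ _)
                      (cong (pathLengths block₁ ++_) (trans (map-++ _ block₂ _) (cong (pathLengths block₂ ++_) (map-++ _ block₃ _))))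
    regroup : evens (l + ((l + 2) + l)) ++ odds ≡ evens l ++ evens (l + 2) ++ evens l ++ odds
    regroup = trans (cong (_++ odds) (trans (replicate-+ l ((l + 2) + l) (4 * l)) (cong (evens l ++_) (replicate-+ (l + 2) l (4 * l)))))
                    (trans (++-assoc (evens l) (evens (l + 2) ++ evens l) odds) (cong (evens l ++_) (++-assoc (evens (l + 2)) (evens l) odds)))
    three-blocks : ∀ n → 3 * suc n + 2 ≡ suc n + ((suc n + 2) + suc n)
    three-blocks = solve-∀

  zigzag-++-alternating : ∀ k a b c (T : List ℕ) → a + (k * s + b) ≡ c → Alternating (c + s) c (b ∷ T) →
                          Alternating c (c + s) (zigzag a b (suc k) ++ T)
  zigzag-++-alternating zero    a b c T a+b≡c alt = a+b≡c , alt
  zigzag-++-alternating (suc k) a b c T first≡c alt =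
    first≡c , trans (turn a s k b) (cong (_+ s) first≡c) , zigzag-++-alternating k (a + s) b c T (trans (step a s k b) first≡c) alt
    where
    turn : ∀ a s k b → ((s + k * s) + b) + (a + s) ≡ (a + ((s + k * s) + b)) + s
    turn = solve-∀
    step : ∀ a s k b → (a + s) + (k * s + b) ≡ a + ((s + k * s) + b)
    step = solve-∀

  zigzag-alternating : ∀ k a b c → a + (k * s + b) ≡ c → Alternating c (c + s) (zigzag a b (suc k))
  zigzag-alternating k a b c a+b≡c =
    subst (Alternating c (c + s)) (++-identityʳ (zigzag a b (suc k))) (zigzag-++-alternating k a b c [] a+b≡c tt)

  low+high≡M : ∀ x x′ → x + x′ ≡ s → x + (K * s + D x′) ≡ M
  low+high≡M x x′ x+x′≡s = trans (regroup L x x′) (trans (cong (_+ (K * s + D₀)) x+x′≡s) (total L))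
    where
    regroup : ∀ n x x′ → x + ((2 * n + 1) * (4 * suc n + 2) + (2 * suc n * (4 * suc n + 2) + suc n + 1 + x′))
                         ≡ (x + x′) + ((2 * n + 1) * (4 * suc n + 2) + (2 * suc n * (4 * suc n + 2) + suc n + 1))
    regroup = solve-∀
    total : ∀ n → (4 * suc n + 2) + ((2 * n + 1) * (4 * suc n + 2) + (2 * suc n * (4 * suc n + 2) + suc n + 1))
                  ≡ 4 * suc n * (4 * suc n + 2) + suc n + 1
    total = solve-∀

  high+low≡M : ∀ x x′ → x + x′ ≡ s → D x′ + (K * s + x) ≡ M
  high+low≡M x x′ x+x′≡s = trans (swap (D x′) (K * s) x) (low+high≡M x x′ x+x′≡s)
    where
    swap : ∀ d k x → d + (k + x) ≡ x + (k + d)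
    swap = solve-∀

  top+D≡M+s : ∀ x x′ → x + x′ ≡ s → top x + D x′ ≡ M + s
  top+D≡M+s x x′ x+x′≡s = trans (regroup L x x′) (trans (cong (_+ (top 0 + D₀)) x+x′≡s) (total L))
    where
    regroup : ∀ n x x′ → (x + 2 * suc n * (4 * suc n + 2)) + (2 * suc n * (4 * suc n + 2) + suc n + 1 + x′)
                         ≡ (x + x′) + ((0 + 2 * suc n * (4 * suc n + 2)) + (2 * suc n * (4 * suc n + 2) + suc n + 1))
    regroup = solve-∀
    total : ∀ n → (4 * suc n + 2) + ((0 + 2 * suc n * (4 * suc n + 2)) + (2 * suc n * (4 * suc n + 2) + suc n + 1))
                  ≡ 4 * suc n * (4 * suc n + 2) + suc n + 1 + (4 * suc n + 2)
    total = solve-∀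

  1+[4l+1]≡s : 1 + (4 * l + 1) ≡ s
  1+[4l+1]≡s = sym (+-suc (4 * l) 1)

  evenLow-alternating : ∀ x x′ → x + x′ ≡ s → Alternating M (M + s) (pathLabels (evenLow x x′))
  evenLow-alternating x x′ x+x′≡s = zigzag-alternating K x (D x′) M (low+high≡M x x′ x+x′≡s)

  evenHigh-alternating : ∀ x x′ → x + x′ ≡ s → Alternating M (M + s) (pathLabels (evenHigh x x′))
  evenHigh-alternating x x′ x+x′≡s = zigzag-alternating K (D x′) x M (high+low≡M x x′ x+x′≡s)

  oddLow-alternating : Alternating M (M + s) (pathLabels oddLow)
  oddLow-alternating =
    zigzag-++-alternating K 1 (D (4 * l + 1)) M (top 1 ∷ []) (low+high≡M 1 (4 * l + 1) 1+[4l+1]≡s)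
      (trans (+-comm (D (4 * l + 1)) (top 1)) (top+D≡M+s 1 (4 * l + 1) 1+[4l+1]≡s) , tt)

  oddHigh-alternating : ∀ x x′ → x + x′ ≡ s → Alternating (M + s) M (pathLabels (oddHigh x x′))
  oddHigh-alternating x x′ x+x′≡s = top+D≡M+s x x′ x+x′≡s , evenHigh-alternating x x′ x+x′≡s

rangeSum : ℕ → ℕ → ℕ
rangeSum x zero    = 0
rangeSum x (suc k) = x + rangeSum (suc x) k

rangeSum-shift : ∀ x k → rangeSum x k ≡ k * x + rangeSum 0 k
rangeSum-shift x zero    = refl
rangeSum-shift x (suc k) =
  trans (cong (x +_) (rangeSum-shift (suc x) k))
        (trans (regroup x k (rangeSum 0 k)) (cong (λ z → x + k * x + z) (sym (rangeSum-shift 1 k))))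
  where
  regroup : ∀ x k A → x + (k * suc x + A) ≡ x + k * x + (k * 1 + A)
  regroup = solve-∀

rangeSum-suc : ∀ x k → rangeSum x (suc k) ≡ rangeSum x k + (x + k)
rangeSum-suc x zero    = refl
rangeSum-suc x (suc k) = trans (cong (x +_) (rangeSum-suc (suc x) k)) (regroup x k (rangeSum (suc x) k))
  where
  regroup : ∀ x k A → x + (A + (suc x + k)) ≡ (x + A) + (x + suc k)
  regroup = solve-∀

lastOf-∷ʳ : ∀ w (xs : List ℕ) z → lastOf w (xs ++ z ∷ []) ≡ z
lastOf-∷ʳ w []       z = refl
lastOf-∷ʳ w (x ∷ xs) z = lastOf-∷ʳ x xs z

module Balance (L : ℕ) where
  open Construction L

  lastOf-zigzag : ∀ k a b → lastOf (k * s + b) (zigzag a b k) ≡ b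
  lastOf-zigzag zero    a b = refl
  lastOf-zigzag (suc k) a b = lastOf-zigzag k (a + s) b

  private
    peel : ∀ d y k A → (d + (y + k)) + (k * d + A) ≡ (d + k * d) + (A + (y + k))
    peel = solve-∀

  uSum-evenLow : ∀ x y k → uSum (series evenLow x y k) ≡ rangeSum x k
  uSum-evenLow x y zero    = refl
  uSum-evenLow x y (suc k) = cong (x +_) (uSum-evenLow (suc x) y k)

  vSum-evenLow : ∀ x y k → vSum (series evenLow x y k) ≡ k * D₀ + rangeSum y k
  vSum-evenLow x y zero    = refl
  vSum-evenLow x y (suc k) =
    trans (cong₂ _+_ (lastOf-zigzag K (x + s) (D (y + k))) (vSum-evenLow (suc x) y k))
          (trans (peel D₀ y k (rangeSum y k)) (cong (D₀ + k * D₀ +_) (sym (rangeSum-suc y k))))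

  uSum-evenHigh : ∀ x y k → uSum (series evenHigh x y k) ≡ k * D₀ + rangeSum y k
  uSum-evenHigh x y zero    = refl
  uSum-evenHigh x y (suc k) =
    trans (cong (D (y + k) +_) (uSum-evenHigh (suc x) y k))
          (trans (peel D₀ y k (rangeSum y k)) (cong (D₀ + k * D₀ +_) (sym (rangeSum-suc y k))))

  vSum-evenHigh : ∀ x y k → vSum (series evenHigh x y k) ≡ rangeSum x k
  vSum-evenHigh x y zero    = refl
  vSum-evenHigh x y (suc k) = cong₂ _+_ (lastOf-zigzag K (D (y + k) + s) x) (vSum-evenHigh (suc x) y k)

  uSum-oddHigh : ∀ x y k → uSum (series oddHigh x y k) ≡ rangeSum x k + k * (2 * l * s)
  uSum-oddHigh x y zero    = refl
  uSum-oddHigh x y (suc k) = trans (cong (top x +_) (uSum-oddHigh (suc x) y k)) (regroup x (2 * l * s) k (rangeSum (suc x) k))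
    where
    regroup : ∀ x T k A → (x + T) + (A + k * T) ≡ (x + A) + (T + k * T)
    regroup = solve-∀

  vSum-oddHigh : ∀ x y k → vSum (series oddHigh x y k) ≡ rangeSum x k
  vSum-oddHigh x y zero    = refl
  vSum-oddHigh x y (suc k) = cong₂ _+_ (lastOf-zigzag K (D (y + k) + s) x) (vSum-oddHigh (suc x) y k)

  T T₃ : ℕ
  T  = rangeSum 0 L
  T₃ = ((T + L) + suc L) + suc (suc L)

  rangeSum-l : rangeSum 0 l ≡ T + L
  rangeSum-l = rangeSum-suc 0 L

  rangeSum-l+2 : rangeSum 0 (l + 2) ≡ T₃
  rangeSum-l+2 = trans (cong (rangeSum 0) (+-comm (suc L) 2))
    (trans (rangeSum-suc 0 (suc (suc L))) (cong (_+ suc (suc L)) (trans (rangeSum-suc 0 (suc L)) (cong (_+ suc L) rangeSum-l))))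

  uSum-blocks : uSum labelledPaths ≡
    (l * (l + 1) + (T + L)) + (((l + 2) * D₀ + ((l + 2) * l + T₃)) + ((l * (3 * l + 3) + (T + L)) + (1 + ((L * 2 + T) + L * (2 * l * s)))))
  uSum-blocks = trans (uSum-++ block₁ _) (cong₂ _+_ u₁ (trans (uSum-++ block₂ _)
                  (cong₂ _+_ u₂ (trans (uSum-++ block₃ _) (cong₂ _+_ u₃ uOdd)))))
    where
    u₁ : uSum block₁ ≡ l * (l + 1) + (T + L)
    u₁ = trans (uSum-evenLow (l + 1) (2 * l + 2) l) (trans (rangeSum-shift (l + 1) l) (cong (l * (l + 1) +_) rangeSum-l))
    u₂ : uSum block₂ ≡ (l + 2) * D₀ + ((l + 2) * l + T₃)
    u₂ = trans (uSum-evenHigh (2 * l + 1) l (l + 2))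
               (cong ((l + 2) * D₀ +_) (trans (rangeSum-shift l (l + 2)) (cong ((l + 2) * l +_) rangeSum-l+2)))
    u₃ : uSum block₃ ≡ l * (3 * l + 3) + (T + L)
    u₃ = trans (uSum-evenLow (3 * l + 3) 0 l) (trans (rangeSum-shift (3 * l + 3) l) (cong (l * (3 * l + 3) +_) rangeSum-l))
    uOdd : uSum blockOdd ≡ 1 + ((L * 2 + T) + L * (2 * l * s))
    uOdd = cong (1 +_) (trans (uSum-oddHigh 2 (3 * l + 2) L) (cong (_+ L * (2 * l * s)) (rangeSum-shift 2 L)))

  vSum-blocks : vSum labelledPaths ≡
    (l * D₀ + (l * (2 * l + 2) + (T + L))) + (((l + 2) * (2 * l + 1) + T₃) + ((l * D₀ + (T + L)) + ((1 + 2 * l * s) + (L * 2 + T))))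
  vSum-blocks = trans (vSum-++ block₁ _) (cong₂ _+_ v₁ (trans (vSum-++ block₂ _)
                  (cong₂ _+_ v₂ (trans (vSum-++ block₃ _) (cong₂ _+_ v₃ vOdd)))))
    where
    v₁ : vSum block₁ ≡ l * D₀ + (l * (2 * l + 2) + (T + L))
    v₁ = trans (vSum-evenLow (l + 1) (2 * l + 2) l)
               (cong (l * D₀ +_) (trans (rangeSum-shift (2 * l + 2) l) (cong (l * (2 * l + 2) +_) rangeSum-l)))
    v₂ : vSum block₂ ≡ (l + 2) * (2 * l + 1) + T₃
    v₂ = trans (vSum-evenHigh (2 * l + 1) l (l + 2)) (trans (rangeSum-shift (2 * l + 1) (l + 2)) (cong ((l + 2) * (2 * l + 1) +_) rangeSum-l+2))
    v₃ : vSum block₃ ≡ l * D₀ + (T + L)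
    v₃ = trans (vSum-evenLow (3 * l + 3) 0 l) (cong (l * D₀ +_) rangeSum-l)
    vOdd : vSum blockOdd ≡ (1 + 2 * l * s) + (L * 2 + T)
    vOdd = cong₂ _+_ (lastOf-∷ʳ _ (zigzag (1 + s) (D (4 * l + 1)) K) (top 1)) (trans (vSum-oddHigh 2 (3 * l + 2) L) (rangeSum-shift 2 L))

  -- T enters both sides with the same coefficient, so the identity holds for arbitrary T.
  uSum≡vSum : uSum labelledPaths ≡ vSum labelledPaths
  uSum≡vSum = trans uSum-blocks (trans (identity L T) (sym vSum-blocks))
    where
    identity : ∀ L T →
      let l = suc L ; s = 4 * suc L + 2 ; D₀ = 2 * suc L * (4 * suc L + 2) + suc L + 1
          T₃ = ((T + L) + suc L) + suc (suc L) in
      (l * (l + 1) + (T + L)) + (((l + 2) * D₀ + ((l + 2) * l + T₃)) + ((l * (3 * l + 3) + (T + L)) + (1 + ((L * 2 + T) + L * (2 * l * s)))))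
      ≡ (l * D₀ + (l * (2 * l + 2) + (T + L))) + (((l + 2) * (2 * l + 1) + T₃) + ((l * D₀ + (T + L)) + ((1 + 2 * l * s) + (L * 2 + T))))
    identity = solve-∀

  -- The l + 2 descending heads of block₂ alone already exceed M + s.
  M+s<uSum : M + s < uSum labelledPaths
  M+s<uSum = ≤-trans (subst (M + s <_) (sym (heads-of-block₂ L)) (m<m+n (M + s) (s≤s z≤n)))
                     (subst ((l + 2) * D₀ ≤_) (sym uSum-blocks) (inside (l * (l + 1) + (T + L)) ((l + 2) * D₀) _ _))
    where
    inside : ∀ X Y B R → Y ≤ X + ((Y + B) + R)
    inside X Y B R = ≤-trans (m≤m+n Y B) (≤-trans (m≤m+n (Y + B) R) (m≤n+m _ X))
    heads-of-block₂ : ∀ L → (suc L + 2) * (2 * suc L * (4 * suc L + 2) + suc L + 1)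
      ≡ (4 * suc L * (4 * suc L + 2) + suc L + 1 + (4 * suc L + 2)) + suc (8 * L * L * L + 29 * L * L + 32 * L + 9)
    heads-of-block₂ = solve-∀

module Labels (L : ℕ) where
  open Construction L

  edgeCount : ℕ
  edgeCount = 4 * l * s + l

  zigzag-∋ˡ : ∀ k a b i → i < k → a + i * s ∈ zigzag a b k
  zigzag-∋ˡ (suc k) a b zero    _         = here (+-identityʳ a)
  zigzag-∋ˡ (suc k) a b (suc i) (s≤s i<k) =
    there (there (subst (_∈ zigzag (a + s) b k) (+-assoc a s (i * s)) (zigzag-∋ˡ k (a + s) b i i<k)))

  zigzag-∋ʳ : ∀ k a b i → i < k → i * s + b ∈ zigzag a b k
  zigzag-∋ʳ (suc k) a b i i<1+k with m≤n⇒m<n∨m≡n (s≤s⁻¹ i<1+k)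
  ... | inj₂ refl = there (here refl)
  ... | inj₁ i<k  = there (there (zigzag-∋ʳ k (a + s) b i i<k))

  zigzag-All : ∀ (P : ℕ → Set) k a b → (∀ i → i < k → P (a + i * s)) → (∀ i → i < k → P (i * s + b)) →
               All P (zigzag a b k)
  zigzag-All P zero    a b _  _  = []
  zigzag-All P (suc k) a b Pa Pb =
    subst P (+-identityʳ a) (Pa 0 (s≤s z≤n)) ∷ Pb k ≤-refl
    ∷ zigzag-All P k (a + s) b (λ i i< → subst P (sym (+-assoc a s (i * s))) (Pa (suc i) (s≤s i<)))
                               (λ i i< → Pb i (m<n⇒m<1+n i<))

  InRange : ℕ → Set
  InRange w = 1 ≤ w × w ≤ edgeCount

  ascending-InRange : ∀ a i → 1 ≤ a → a ≤ s → i ≤ K → InRange (a + i * s)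
  ascending-InRange a i 1≤a a≤s i≤K =
    ≤-trans 1≤a (m≤m+n a _) ,
    ≤-trans (+-mono-≤ a≤s (*-monoˡ-≤ s i≤K)) (subst (s + K * s ≤_) (sym (split L)) (m≤m+n _ _))
    where
    split : ∀ n → 4 * suc n * (4 * suc n + 2) + suc n
                  ≡ ((4 * suc n + 2) + (2 * n + 1) * (4 * suc n + 2)) + (2 * suc n * (4 * suc n + 2) + suc n)
    split = solve-∀

  descending-InRange : ∀ b i → b < s → i ≤ K → InRange (i * s + D b)
  descending-InRange b i b<s i≤K =
    ≤-trans (s≤s z≤n) (m≤n+m (D b) (i * s)) ,
    ≤-trans (+-monoˡ-≤ (D b) (*-monoˡ-≤ s i≤K))
            (s≤s⁻¹ (subst₂ _≤_ (shift L b) (top-label L) (+-monoʳ-≤ (K * s) (+-monoʳ-≤ D₀ b<s))))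
    where
    shift : ∀ n b → (2 * n + 1) * (4 * suc n + 2) + ((2 * suc n * (4 * suc n + 2) + suc n + 1) + suc b)
                    ≡ suc ((2 * n + 1) * (4 * suc n + 2) + (2 * suc n * (4 * suc n + 2) + suc n + 1 + b))
    shift = solve-∀
    top-label : ∀ n → (2 * n + 1) * (4 * suc n + 2) + ((2 * suc n * (4 * suc n + 2) + suc n + 1) + (4 * suc n + 2))
                      ≡ suc (4 * suc n * (4 * suc n + 2) + suc n)
    top-label = solve-∀

  top-InRange : ∀ a → a ≤ l → InRange (top a)
  top-InRange a a≤l =
    ≤-trans (s≤s z≤n) (m≤n+m _ a) ,
    ≤-trans (+-monoˡ-≤ (2 * l * s) a≤l) (subst (l + 2 * l * s ≤_) (sym (split L)) (m≤m+n _ _))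
    where
    split : ∀ n → 4 * suc n * (4 * suc n + 2) + suc n ≡ (suc n + 2 * suc n * (4 * suc n + 2)) + 2 * suc n * (4 * suc n + 2)
    split = solve-∀

  private
    b<s : ∀ a b → 1 ≤ a → a + b ≡ s → b < s
    b<s a b 1≤a e = subst (b <_) e (+-monoˡ-≤ b 1≤a)

    a≤s : ∀ a b → a + b ≡ s → a ≤ s
    a≤s a b e = subst (a ≤_) e (m≤m+n a b)

  evenLow-InRange : ∀ a b → 1 ≤ a → a + b ≡ s → All InRange (pathLabels (evenLow a b))
  evenLow-InRange a b 1≤a e = zigzag-All InRange (suc K) a (D b)
    (λ i i< → ascending-InRange a i 1≤a (a≤s a b e) (s≤s⁻¹ i<))
    (λ i i< → descending-InRange b i (b<s a b 1≤a e) (s≤s⁻¹ i<))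

  evenHigh-InRange : ∀ a b → 1 ≤ a → a + b ≡ s → All InRange (pathLabels (evenHigh a b))
  evenHigh-InRange a b 1≤a e = zigzag-All InRange (suc K) (D b) a
    (λ i i< → subst InRange (+-comm (i * s) (D b)) (descending-InRange b i (b<s a b 1≤a e) (s≤s⁻¹ i<)))
    (λ i i< → subst InRange (+-comm a (i * s)) (ascending-InRange a i 1≤a (a≤s a b e) (s≤s⁻¹ i<)))

  oddLow-InRange : All InRange (pathLabels oddLow)
  oddLow-InRange = ++⁺ {xs = zigzag 1 (D (4 * l + 1)) (suc K)} (evenLow-InRange 1 (4 * l + 1) (s≤s z≤n) 1+[4l+1]≡s)
                       (top-InRange 1 (s≤s z≤n) ∷ [])

  oddHigh-InRange : ∀ a b → 1 ≤ a → a ≤ l → a + b ≡ s → All InRange (pathLabels (oddHigh a b))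
  oddHigh-InRange a b 1≤a a≤l e = top-InRange a a≤l ∷ evenHigh-InRange a b 1≤a e

  allLabels-InRange : All InRange (allLabels labelledPaths)
  allLabels-InRange = All-allLabels (++⁺ block₁-InRange (++⁺ block₂-InRange (++⁺ block₃-InRange (oddLow-InRange ∷ odd-InRange))))
    where
    InRange′ : PathLabels → Set
    InRange′ p = All InRange (pathLabels p)
    block₁-InRange : All InRange′ block₁
    block₁-InRange = series-All InRange′ evenLow s l (l + 1) (2 * l + 2) block₁-layout
                                (λ a b x≤a _ → evenLow-InRange a b (≤-trans (s≤s z≤n) x≤a))
    block₂-InRange : All InRange′ block₂
    block₂-InRange = series-All InRange′ evenHigh s (l + 2) (2 * l + 1) l block₂-layout
                                (λ a b x≤a _ → evenHigh-InRange a b (≤-trans (s≤s z≤n) x≤a))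
    block₃-InRange : All InRange′ block₃
    block₃-InRange = series-All InRange′ evenLow s l (3 * l + 3) 0 block₃-layout
                                (λ a b x≤a _ → evenLow-InRange a b (≤-trans (s≤s z≤n) x≤a))
    odd-InRange : All InRange′ (series oddHigh 2 (3 * l + 2) L)
    odd-InRange = series-All InRange′ oddHigh s L 2 (3 * l + 2) blockOdd-layout
                             (λ a b 2≤a a< → oddHigh-InRange a b (≤-trans (s≤s z≤n) 2≤a) (s≤s⁻¹ a<))

  private
    in₁ : ∀ {p} → p ∈ block₁ → p ∈ labelledPaths
    in₁ = ∈-++⁺ˡ
    in₂ : ∀ {p} → p ∈ block₂ → p ∈ labelledPaths
    in₂ p∈ = ∈-++⁺ʳ block₁ (∈-++⁺ˡ p∈)
    in₃ : ∀ {p} → p ∈ block₃ → p ∈ labelledPaths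
    in₃ p∈ = ∈-++⁺ʳ block₁ (∈-++⁺ʳ block₂ (∈-++⁺ˡ p∈))
    inOdd : ∀ {p} → p ∈ blockOdd → p ∈ labelledPaths
    inOdd p∈ = ∈-++⁺ʳ block₁ (∈-++⁺ʳ block₂ (∈-++⁺ʳ block₃ p∈))

    l≤s : l ≤ s
    l≤s = ≤-trans (m≤n*m l 4) (m≤m+n (4 * l) 2)

    by-small : ∀ p {k x y} → x + (y + k) ≡ suc s → ∀ a → x ≤ a → a < x + k → a ≤ s → p a (s ∸ a) ∈ series p x y k
    by-small p layout a x≤a a< a≤s = series-∋ p s _ _ _ a (s ∸ a) layout x≤a a< (m+[n∸m]≡n a≤s)

    by-large : ∀ p {k x y} → x + (y + k) ≡ suc s → ∀ b → y ≤ b → b < y + k → b < s → p (s ∸ b) b ∈ series p x y k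
    by-large p layout b y≤b b< b<s = series-∋′ p s _ _ _ (s ∸ b) b layout y≤b b< (m∸n+n≡m (<⇒≤ b<s))

  evenLow-∋low : ∀ a b q → q ≤ K → a + q * s ∈ pathLabels (evenLow a b)
  evenLow-∋low a b q q≤K = zigzag-∋ˡ (suc K) a (D b) q (s≤s q≤K)

  evenLow-∋high : ∀ a b q → q ≤ K → q * s + D b ∈ pathLabels (evenLow a b)
  evenLow-∋high a b q q≤K = zigzag-∋ʳ (suc K) a (D b) q (s≤s q≤K)

  evenHigh-∋low : ∀ a b q → q ≤ K → a + q * s ∈ pathLabels (evenHigh a b)
  evenHigh-∋low a b q q≤K = subst (_∈ zigzag (D b) a (suc K)) (+-comm (q * s) a) (zigzag-∋ʳ (suc K) (D b) a q (s≤s q≤K))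

  evenHigh-∋high : ∀ a b q → q ≤ K → q * s + D b ∈ pathLabels (evenHigh a b)
  evenHigh-∋high a b q q≤K = subst (_∈ zigzag (D b) a (suc K)) (+-comm (D b) (q * s)) (zigzag-∋ˡ (suc K) (D b) a q (s≤s q≤K))

  -- The labels r + q s with 1 ≤ r ≤ l sit on the odd paths.
  small-residue-covered : ∀ r q → 1 ≤ r → r ≤ l → q ≤ suc K → r + q * s ∈ allLabels labelledPaths
  small-residue-covered r q 1≤r r≤l q≤ with q ≤? K
  small-residue-covered 1 q _ _ _ | yes q≤K =
    ∈-allLabels (∈-++⁺ˡ (evenLow-∋low 1 (4 * l + 1) q q≤K)) (inOdd (here refl))
  small-residue-covered (suc (suc r)) q _ r≤l _ | yes q≤K =
    ∈-allLabels (there (evenHigh-∋low (suc (suc r)) _ q q≤K))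
                (inOdd (there (by-small oddHigh blockOdd-layout (suc (suc r)) (s≤s (s≤s z≤n)) (s≤s r≤l) (≤-trans r≤l l≤s))))
  small-residue-covered r q 1≤r r≤l q≤ | no q≰K =
    subst (λ z → r + z ∈ allLabels labelledPaths) (trans (top-multiple L) (cong (_* s) (sym q≡K+1))) (top-covered r 1≤r r≤l)
    where
    q≡K+1 : q ≡ suc K
    q≡K+1 = ≤-antisym q≤ (≰⇒> q≰K)
    top-multiple : ∀ n → 2 * suc n * (4 * suc n + 2) ≡ suc (2 * n + 1) * (4 * suc n + 2)
    top-multiple = solve-∀
    top-covered : ∀ r → 1 ≤ r → r ≤ l → top r ∈ allLabels labelledPaths
    top-covered 1             _ _   = ∈-allLabels (∈-++⁺ʳ (zigzag 1 (D (4 * l + 1)) (suc K)) (here refl)) (inOdd (here refl))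
    top-covered (suc (suc r)) _ r≤l =
      ∈-allLabels (here refl)
                  (inOdd (there (by-small oddHigh blockOdd-layout (suc (suc r)) (s≤s (s≤s z≤n)) (s≤s r≤l) (≤-trans r≤l l≤s))))

  -- The labels r + q s with l < r ≤ s sit on the even paths, at the end with label r.
  large-residue-covered : ∀ r q → l < r → r ≤ s → q ≤ K → r + q * s ∈ allLabels labelledPaths
  large-residue-covered r q l<r r≤s q≤K with r ≤? 2 * l
  ... | yes r≤2l =
    ∈-allLabels (evenLow-∋low r _ q q≤K)
                (in₁ (by-small evenLow block₁-layout r (subst (_≤ r) (+-comm 1 l) l<r) (subst (r <_) (sym (bound₁ L)) (s≤s r≤2l)) r≤s))
    where
    bound₁ : ∀ n → suc n + 1 + suc n ≡ suc (2 * suc n)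
    bound₁ = solve-∀
  ... | no r≰2l with r ≤? 3 * l + 2
  ...   | yes r≤3l+2 =
    ∈-allLabels (evenHigh-∋low r _ q q≤K)
                (in₂ (by-small evenHigh block₂-layout r (subst (_≤ r) (+-comm 1 (2 * l)) (≰⇒> r≰2l))
                                                        (subst (r <_) (sym (bound₂ L)) (s≤s r≤3l+2)) r≤s))
    where
    bound₂ : ∀ n → (2 * suc n + 1) + (suc n + 2) ≡ suc (3 * suc n + 2)
    bound₂ = solve-∀
  ...   | no r≰3l+2 =
    ∈-allLabels (evenLow-∋low r _ q q≤K)
                (in₃ (by-small evenLow block₃-layout r (subst (_≤ r) (bound₃ L) (≰⇒> r≰3l+2))
                                                       (subst (r <_) (sym (bound₄ L)) (s≤s r≤s)) r≤s))
    where
    bound₃ : ∀ n → suc (3 * suc n + 2) ≡ 3 * suc n + 3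
    bound₃ = solve-∀
    bound₄ : ∀ n → (3 * suc n + 3) + suc n ≡ suc (4 * suc n + 2)
    bound₄ = solve-∀

  lower-label-covered : ∀ r q → 1 ≤ r → r ≤ s → r + q * s ≤ 2 * l * s + l → r + q * s ∈ allLabels labelledPaths
  lower-label-covered r q 1≤r r≤s bound with r ≤? l
  ... | yes r≤l = small-residue-covered r q 1≤r r≤l (subst (q ≤_) (sym (two-l L)) (s≤s⁻¹ q<2l+1))
    where
    two-l : ∀ n → suc (2 * n + 1) ≡ 2 * suc n
    two-l = solve-∀
    beyond : ∀ n → suc (2 * suc n * (4 * suc n + 2) + suc n) + (3 * n + 4) ≡ suc (2 * suc n) * (4 * suc n + 2)
    beyond = solve-∀
    q<2l+1 : q < suc (2 * l)
    q<2l+1 = *-cancelʳ-< s q (suc (2 * l)) (≤-<-trans (≤-trans (m≤n+m (q * s) r) bound)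
                                                       (subst (suc (2 * l * s + l) ≤_) (beyond L) (m≤m+n _ _)))
  ... | no r≰l = large-residue-covered r q (≰⇒> r≰l) r≤s (s≤s⁻¹ (*-cancelʳ-< s q (suc K) (subst (q * s <_) (two-l-s L) qs<)))
    where
    two-l-s : ∀ n → 2 * suc n * (4 * suc n + 2) ≡ suc (2 * n + 1) * (4 * suc n + 2)
    two-l-s = solve-∀
    qs< : q * s < 2 * l * s
    qs< = +-cancelˡ-≤ l _ _ (subst₂ _≤_ (sym (+-suc l (q * s))) (+-comm (2 * l * s) l)
                                      (≤-trans (+-monoˡ-≤ (q * s) (≰⇒> r≰l)) bound))

  upper-label-covered : ∀ x′ q → x′ < s → q ≤ K → q * s + D x′ ∈ allLabels labelledPaths
  upper-label-covered x′ q x′<s q≤K with x′ <? l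
  ... | yes x′<l = ∈-allLabels (evenLow-∋high _ x′ q q≤K) (in₃ (by-large evenLow block₃-layout x′ z≤n x′<l x′<s))
  ... | no x′≮l with x′ ≤? 2 * l + 1
  ...   | yes x′≤ =
    ∈-allLabels (evenHigh-∋high _ x′ q q≤K)
                (in₂ (by-large evenHigh block₂-layout x′ (≮⇒≥ x′≮l) (subst (x′ <_) (bound₁ L) (s≤s x′≤)) x′<s))
    where
    bound₁ : ∀ n → suc (2 * suc n + 1) ≡ suc n + (suc n + 2)
    bound₁ = solve-∀
  ...   | no x′≰ with x′ ≤? 3 * l + 1
  ...     | yes x′≤ =
    ∈-allLabels (evenLow-∋high _ x′ q q≤K)
                (in₁ (by-large evenLow block₁-layout x′ (subst (_≤ x′) (bound₂ L) (≰⇒> x′≰))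
                                                        (subst (x′ <_) (bound₃ L) (s≤s x′≤)) x′<s))
    where
    bound₂ : ∀ n → suc (2 * suc n + 1) ≡ 2 * suc n + 2
    bound₂ = solve-∀
    bound₃ : ∀ n → suc (3 * suc n + 1) ≡ (2 * suc n + 2) + suc n
    bound₃ = solve-∀
  ...     | no x′≰′ with x′ ≤? 4 * l
  ...       | yes x′≤ =
    ∈-allLabels (there (evenHigh-∋high _ x′ q q≤K))
                (inOdd (there (by-large oddHigh blockOdd-layout x′ (subst (_≤ x′) (bound₄ L) (≰⇒> x′≰′))
                                                                   (subst (x′ <_) (bound₅ L) (s≤s x′≤)) x′<s)))
    where
    bound₄ : ∀ n → suc (3 * suc n + 1) ≡ 3 * suc n + 2
    bound₄ = solve-∀
    bound₅ : ∀ n → suc (4 * suc n) ≡ (3 * suc n + 2) + n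
    bound₅ = solve-∀
  ...       | no x′≰4l = subst (λ z → q * s + D z ∈ allLabels labelledPaths) (sym x′≡4l+1)
                               (∈-allLabels (∈-++⁺ˡ (evenLow-∋high 1 (4 * l + 1) q q≤K)) (inOdd (here refl)))
    where
    bound₆ : ∀ n → 4 * suc n + 2 ≡ suc (4 * suc n + 1)
    bound₆ = solve-∀
    bound₇ : ∀ n → suc (4 * suc n) ≡ 4 * suc n + 1
    bound₇ = solve-∀
    x′≡4l+1 : x′ ≡ 4 * l + 1
    x′≡4l+1 = ≤-antisym (s≤s⁻¹ (subst (x′ <_) (bound₆ L) x′<s)) (subst (_≤ x′) (bound₇ L) (≰⇒> x′≰4l))

  -- Divide by s: labels up to 2ls + l are r + q s with 1 ≤ r ≤ s, larger ones are D x′ + q s with x′ < s.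
  allLabels-cover : ∀ w → 1 ≤ w → w ≤ edgeCount → w ∈ allLabels labelledPaths
  allLabels-cover w 1≤w w≤ with w ≤? 2 * l * s + l
  allLabels-cover (suc v) _ _ | yes lower =
    subst (_∈ allLabels labelledPaths) (cong suc (sym v≡))
          (lower-label-covered (suc (v % s)) (v / s) (s≤s z≤n) (m%n<n v s) (subst (_≤ 2 * l * s + l) (cong suc v≡) lower))
    where
    v≡ : v ≡ v % s + v / s * s
    v≡ = m≡m%n+[m/n]*n v s
  allLabels-cover w 1≤w w≤ | no upper =
    subst (_∈ allLabels labelledPaths) (trans (sym (regroup (D₀) (v % s) (v / s * s))) (trans (cong (D₀ +_) (sym v≡)) D₀+v≡w))
          (upper-label-covered (v % s) (v / s) (m%n<n v s) (s≤s⁻¹ (*-cancelʳ-< s (v / s) (suc K) (≤-<-trans qs≤v v<))))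
    where
    regroup : ∀ d x q → d + (x + q) ≡ q + (d + x)
    regroup = solve-∀
    v : ℕ
    v = w ∸ D₀
    D₀+v≡w : D₀ + v ≡ w
    D₀+v≡w = m+[n∸m]≡n (subst (_≤ w) (+-comm 1 (2 * l * s + l)) (≰⇒> upper))
    v≡ : v ≡ v % s + v / s * s
    v≡ = m≡m%n+[m/n]*n v s
    qs≤v : v / s * s ≤ v
    qs≤v = subst (v / s * s ≤_) (sym v≡) (m≤n+m (v / s * s) (v % s))
    split : ∀ n → 4 * suc n * (4 * suc n + 2) + suc n ≡ (2 * suc n * (4 * suc n + 2) + suc n + 1) + (8 * n * n + 20 * n + 11)
    split = solve-∀
    span : ∀ n → suc (8 * n * n + 20 * n + 11) ≡ suc (2 * n + 1) * (4 * suc n + 2)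
    span = solve-∀
    v< : v < suc K * s
    v< = subst (v <_) (span L) (s≤s (+-cancelˡ-≤ (D₀) _ _ (subst₂ _≤_ (sym D₀+v≡w) (split L) w≤)))

sum-replicate : ∀ k a → sum (replicate k a) ≡ k * a
sum-replicate zero    a = refl
sum-replicate (suc k) a = cong (a +_) (sum-replicate k a)

AtMostThree : List ℕ → Set
AtMostThree as = Σ (Labeling (theta as)) λ σ → IsLocalAntimagic (theta as) σ × numColors (theta as) σ ≤ 3

AtLeastThree : List ℕ → Set
AtLeastThree as = (σ : Labeling (theta as)) → IsLocalAntimagic (theta as) σ → 3 ≤ numColors (theta as) σ

module Witness (L : ℕ) where
  open Construction L
  open Balance L using (uSum≡vSum; M+s<uSum)
  open Labels L using (edgeCount; allLabels-InRange; allLabels-cover)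

  G : Graph
  G = theta (pathLengths labelledPaths)

  nE≡edgeCount : nE G ≡ edgeCount
  nE≡edgeCount =
    trans (length-thetaEdges 2 labelledPaths) (trans (length-allLabels labelledPaths) (trans (cong sum pathLengths-labelledPaths)
      (trans (sum-++ (replicate (3 * l + 2) (4 * l)) _) (trans (cong₂ _+_ (sum-replicate (3 * l + 2) (4 * l)) (sum-replicate l (4 * l + 1)))
             (count L)))))
    where
    count : ∀ n → (3 * suc n + 2) * (4 * suc n) + suc n * (4 * suc n + 1) ≡ 4 * suc n * (4 * suc n + 2) + suc n
    count = solve-∀

  open ListLabeling G (allLabels labelledPaths) (length-thetaEdges 2 labelledPaths)
    (All.map (λ {w} (1≤w , w≤) → 1≤w , subst (w ≤_) (sym nE≡edgeCount) w≤) allLabels-InRange)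
    (λ w 1≤w w≤ → allLabels-cover w 1≤w (subst (w ≤_) nE≡edgeCount w≤))

  M≢M+s : M ≢ M + s
  M≢M+s = <⇒≢ (m<m+n M (s≤s z≤n))

  open TwoValued M (M + s) M≢M+s

  alternating : All Alternates labelledPaths
  alternating =
    ++⁺ (series-All Alternates evenLow s l (l + 1) (2 * l + 2) block₁-layout (λ a b _ _ e → inj₁ (evenLow-alternating a b e)))
    (++⁺ (series-All Alternates evenHigh s (l + 2) (2 * l + 1) l block₂-layout (λ a b _ _ e → inj₁ (evenHigh-alternating a b e)))
    (++⁺ (series-All Alternates evenLow s l (3 * l + 3) 0 block₃-layout (λ a b _ _ e → inj₁ (evenLow-alternating a b e)))
         (inj₁ oddLow-alternating
          ∷ series-All Alternates oddHigh s L 2 (3 * l + 2) blockOdd-layout (λ a b _ _ e → inj₂ (oddHigh-alternating a b e)))))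

  V : ℕ → ℕ
  V = fplus G σ

  c : ℕ
  c = uSum labelledPaths

  V0≡c : V 0 ≡ c
  V0≡c = trans (fplus≡edgeSum 0) (thetaSum-u 2 labelledPaths ≤-refl)

  V1≡c : V 1 ≡ c
  V1≡c = trans (fplus≡edgeSum 1) (trans (thetaSum-v 2 labelledPaths ≤-refl) (sym uSum≡vSum))

  c-fresh : NeitherOf c
  c-fresh = (λ e → <⇒≢ (≤-trans (m≤m+n (suc M) s) M+s<uSum) (sym e)) , (λ e → <⇒≢ M+s<uSum (sym e))

  σ-localAntimagic : IsLocalAntimagic G σ
  σ-localAntimagic = Proper⇒localAntimagic G σ
    (thetaEdges-proper V 2 labelledPaths ≤-refl alternating (subst NeitherOf (sym V0≡c) c-fresh) (subst NeitherOf (sym V1≡c) c-fresh)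
                       (λ y _ _ → fplus≡edgeSum y))

  σ-numColors≤3 : numColors G σ ≤ 3
  σ-numColors≤3 = numColors≤3 G σ c M (M + s) sums
    where
    sums : ∀ y → y < nV G → V y ≡ c ⊎ V y ≡ M ⊎ V y ≡ M + s
    sums zero          _  = inj₁ V0≡c
    sums (suc zero)    _  = inj₁ V1≡c
    sums (suc (suc y)) y< = weaken (subst OneOf (sym (fplus≡edgeSum (suc (suc y))))
                                          (thetaSum-inner-OneOf 2 labelledPaths ≤-refl alternating (suc (suc y)) (s≤s (s≤s z≤n)) y<))
      where
      weaken : ∀ {v} → OneOf v → v ≡ c ⊎ v ≡ M ⊎ v ≡ M + s
      weaken (inj₁ v≡M)   = inj₂ (inj₁ v≡M)
      weaken (inj₂ v≡M+s) = inj₂ (inj₂ v≡M+s)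

  atMostThree : AtMostThree (pathLengths labelledPaths)
  atMostThree = σ , σ-localAntimagic , σ-numColors≤3

ChiLaEq-3 : ∀ as → AtMostThree as → AtLeastThree as → ChiLaEq (theta as) 3
ChiLaEq-3 as (σ , la , ≤3) lower = (σ , la , ≤-antisym ≤3 (lower σ la)) , lower

-- The even paths have length 2 + 2K and the odd ones 3 + 2K, with K = 2L + 1.
atLeastThree : ∀ L → AtLeastThree (replicate (3 * suc L + 2) (4 * suc L) ++ replicate (suc L) (4 * suc L + 1))
atLeastThree L = subst AtLeastThree shape
  (theta-mixed-parity⇒3≤numColors K K (replicate (3 * suc L + 1) (4 * suc L)) (replicate L (4 * suc L + 1)))
  where
  K : ℕ
  K = 2 * L + 1
  even : ∀ n → 2 + ((2 * n + 1) + (2 * n + 1)) ≡ 4 * suc n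
  even = solve-∀
  odd : ∀ n → 2 + suc ((2 * n + 1) + (2 * n + 1)) ≡ 4 * suc n + 1
  odd = solve-∀
  shape : (2 + (K + K)) ∷ replicate (3 * suc L + 1) (4 * suc L) ++ (2 + suc (K + K)) ∷ replicate L (4 * suc L + 1)
          ≡ replicate (3 * suc L + 2) (4 * suc L) ++ replicate (suc L) (4 * suc L + 1)
  shape = trans (cong₂ (λ e o → e ∷ replicate (3 * suc L + 1) (4 * suc L) ++ o ∷ replicate L (4 * suc L + 1)) (even L) (odd L))
                (cong (λ n → replicate n (4 * suc L) ++ replicate (suc L) (4 * suc L + 1)) (sym (+-suc (3 * suc L) 1)))

theorem4p1 : (l : ℕ) → 1 ≤ l →
    ChiLaEq (theta (replicate (3 * l + 2) (4 * l) ++ replicate l (4 * l + 1))) 3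
theorem4p1 zero    ()
theorem4p1 (suc L) _ =
  ChiLaEq-3 (replicate (3 * suc L + 2) (4 * suc L) ++ replicate (suc L) (4 * suc L + 1))
            (subst AtMostThree (Construction.pathLengths-labelledPaths L) (Witness.atMostThree L))
            (atLeastThree L)
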